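{- Let $n\ge2$, let $(a_1,\dots,a_n)$ be $n$ distinct elements in uniformly random order, $p=\min(a_1,a_n)$, $q=\max(a_1,a_n)$, and let $S=S_n$, $M=M_n$, $L=L_n$ be the numbers of elements among $a_2,\dots,a_{n-1}$ that are smaller than $p$, between $p$ and $q$, and larger than $q$, respectively. Then $(S,M,L)$ is uniformly distributed on $\Omega'=\{(s,m,\ell)\in\mathbb{N}_0^3: s+m+\ell=n-2\}$; the random variables $S$, $M$, $L$ are identically distributed; $\mathbb{P}(M=m)=\frac{n-m-1}{\binom n2}$ for $0\le m\le n-2$; $\mathbb{E}[M]=\frac{n-2}3$; and \[ \sum_{n\ge2}\mathbb{E}\bigl[|L_n-S_n|\bigr]z^n=\frac1{3(1-z)^2}-\frac1{2(1-z)}-\frac12(z+1)\operatorname{artanh}(z)+\frac16+\frac13z \] as formal power series. -}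

module Defs where

open import Data.Bool using (Bool; true; false; _∧_; if_then_else_)
open import Data.Nat as ℕ using (ℕ; zero; suc; _+_; _∸_; _⊓_; _⊔_; _≡ᵇ_; _<ᵇ_; ∣_-_∣; _%_)
open import Data.Fin as Fin using (Fin; toℕ)
import Data.Fin.Properties as FinP
open import Data.Vec as Vec using (Vec; []; _∷_)
open import Data.List as List using (List; []; _∷_; length; filterᵇ; concatMap; map; allFin; foldr; upTo)
import Data.List.Relation.Unary.Unique.DecPropositional as UDP
open import Data.Product using (_×_; _,_; proj₁; proj₂)
open import Data.Integer using (+_)
open import Data.Rational as ℚ using (ℚ; _/_; 0ℚ; 1ℚ)
open import Relation.Nullary.Decidable using (isYes)

-- W.l.o.g. the n distinct elements are 0,…,n-1 (only their relative
-- order matters), and an ordering (a₁,…,aₙ) is an injective vector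
-- Vec (Fin n) n, i.e. a permutation.

allVecs : ∀ {a} {A : Set a} → List A → (m : ℕ) → List (Vec A m)
allVecs xs zero    = [] ∷ []
allVecs xs (suc m) = concatMap (λ x → map (x ∷_) (allVecs xs m)) xs

Ω : (n : ℕ) → List (Vec (Fin n) n)
Ω n = filterᵇ (λ v → isYes (UDP.unique? (FinP._≟_ {n}) (Vec.toList v))) (allVecs (allFin n) n)

-- q / d, with the junk value 0 when d = 0 (never used: Ω n is nonempty)
_÷ℕ_ : ℚ → ℕ → ℚ
q ÷ℕ zero  = 0ℚ
q ÷ℕ suc d = q ℚ.* ((+ 1) / suc d)

Pr : (n : ℕ) → (Vec (Fin n) n → Bool) → ℚ
Pr n E = (+ length (filterᵇ E (Ω n)) / 1) ÷ℕ length (Ω n)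

Ex : (n : ℕ) → (Vec (Fin n) n → ℕ) → ℚ
Ex n X = foldr (λ ω acc → (+ X ω / 1) ℚ.+ acc) 0ℚ (Ω n) ÷ℕ length (Ω n)

-- For (a₁,…,aₘ) with m ≥ 2: p = min(a₁,aₘ), q = max(a₁,aₘ), and
-- S, M, L count the a₂,…,a_{m-1} smaller than p, strictly between p
-- and q, larger than q. (For m < 2 they are set to 0; never used.)

count : ∀ {m} → (ℕ → Bool) → Vec ℕ m → ℕ
count P v = length (filterᵇ P (Vec.toList v))

SML′ : ∀ {m} → Vec ℕ m → ℕ × ℕ × ℕ
SML′ []           = 0 , 0 , 0
SML′ (x ∷ [])     = 0 , 0 , 0
SML′ (x ∷ y ∷ ys) =
  let v   = y ∷ ys
      b   = Vec.last v
      mid = Vec.init v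
      p   = x ⊓ b
      q   = x ⊔ b
  in count (λ c → c <ᵇ p) mid , count (λ c → (p <ᵇ c) ∧ (c <ᵇ q)) mid , count (λ c → q <ᵇ c) mid

SML : ∀ {n} → Vec (Fin n) n → ℕ × ℕ × ℕ
SML ω = SML′ (Vec.map toℕ ω)

S M L : ∀ {n} → Vec (Fin n) n → ℕ
S ω = proj₁ (SML ω)
M ω = proj₁ (proj₂ (SML ω))
L ω = proj₂ (proj₂ (SML ω))

Ω′ : ℕ → List (ℕ × ℕ × ℕ)
Ω′ N = filterᵇ (λ { (s , m , l) → (s + m + l) ≡ᵇ N })
         (concatMap (λ s → concatMap (λ m → map (λ l → s , m , l) (upTo (suc N))) (upTo (suc N))) (upTo (suc N)))

FPS : Set
FPS = ℕ → ℚ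

_⊕_ _⊖_ _⊛_ : FPS → FPS → FPS
(f ⊕ g) n = f n ℚ.+ g n
(f ⊖ g) n = f n ℚ.- g n
(f ⊛ g) n = foldr (λ i acc → (f i ℚ.* g (n ∸ i)) ℚ.+ acc) 0ℚ (upTo (suc n))

infixl 6 _⊕_ _⊖_
infixl 7 _⊛_ _·_

_·_ : ℚ → FPS → FPS
(c · f) n = c ℚ.* f n

const : ℚ → FPS
const c zero    = c
const c (suc n) = 0ℚ

Z : FPS
Z 1 = 1ℚ
Z _ = 0ℚ

-- 1/(1-z) = Σ_{n≥0} zⁿ
geom : FPS
geom _ = 1ℚ

artanh : FPS
artanh n = if n % 2 ≡ᵇ 1 then 1ℚ ÷ℕ n else 0ℚ

lhsGF : FPS
lhsGF zero          = 0ℚ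
lhsGF (suc zero)    = 0ℚ
lhsGF n@(suc (suc _)) = Ex n (λ ω → ∣ L ω - S ω ∣)

rhsGF : FPS
rhsGF = ((+ 1 / 3) · (geom ⊛ geom))
      ⊖ ((+ 1 / 2) · geom)
      ⊖ ((+ 1 / 2) · ((Z ⊕ const 1ℚ) ⊛ artanh))
      ⊕ const (+ 1 / 6)
      ⊕ ((+ 1 / 3) · Z)

-- Every statistic involved is a function of the endpoint values a = a₁ and b = aₙ: since the
-- values of an ordering enumerate {0, …, n − 1}, S = min(a,b), M = max(a,b) − min(a,b) − 1 and
-- L = n − 1 − max(a,b). Relabelling the values by a permutation maps orderings to orderings, so
-- every ordered pair of distinct endpoint values is attained equally often, and each probability
-- or expectation becomes a sum over the C(n,2) pairs b < a < n divided by C(n,2). On this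
-- triangle (S, M, L) = (b, a − b − 1, n − 1 − a) is a bijection onto Ω′, each of S, M, L takes the
-- value j exactly n − 1 − j times, ∑ M = C(n,3), and ∑ |L − S| has a closed form for each parity
-- of n which matches the coefficient (n + 1)/3 − 1/2 − 1/(2o) of zⁿ on the right-hand side,
-- o being the odd one of n and n − 1.

module Submission where

open import Defs
open import Level using (Level)
open import Data.Bool using (Bool; true; false; not; _∧_; T)
open import Data.Bool.Properties using (∧-zeroʳ; ∧-identityʳ)
open import Data.Fin as Fin using (Fin; toℕ)
import Data.Fin.Properties as Finₚ
open import Data.Fin.Permutation as Perm using (Permutation; _⟨$⟩ʳ_; _⟨$⟩ˡ_)
import Data.Fin.Permutation.Components as PermC
open import Data.List as List
  using (List; []; _∷_; _++_; length; filterᵇ; concatMap; map; allFin; foldr; upTo; applyUpTo)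
open import Data.List.Relation.Unary.All using (All; []; _∷_)
open import Data.List.Relation.Unary.Any as Any using (here; there)
open import Data.List.Membership.Propositional using (_∈_)
import Data.List.Membership.Propositional.Properties as ∈ₚ
open import Data.List.Relation.Unary.AllPairs using ([]; _∷_)
open import Data.List.Relation.Unary.Unique.Propositional using (Unique)
import Data.List.Relation.Unary.Unique.DecPropositional as UniqueDec
import Data.List.Relation.Unary.Unique.Propositional.Properties as Uniqueₚ
open import Data.Nat as ℕ
  using (ℕ; zero; suc; 2+; NonZero; _+_; _*_; _∸_; _≤_; _<_; _≮_; _≡ᵇ_; _<ᵇ_; _⊓_; _⊔_; ∣_-_∣; z≤n; s≤s; _≟_; _<?_; _≤?_)
open import Data.Nat.Properties
open import Data.Nat.DivMod using (m*n%n≡0; [m+kn]%n≡m%n)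
open import Data.Nat.Combinatorics using (_C_; nC1≡n; nCk+nC[k+1]≡[n+1]C[k+1])
open import Algebra.Properties.CommutativeMonoid.Sum +-0-commutativeMonoid using (sum; sum-permute)
open import Data.Nat.Tactic.RingSolver using (solve-∀)
open import Data.Vec as Vec using (Vec; []; _∷_)
import Data.Vec.Properties as Vecₚ
open import Data.Integer as ℤ using (+_)
import Data.Integer.Properties as ℤₚ
open import Data.Rational as ℚ using (ℚ; _/_; 0ℚ; 1ℚ)
import Data.Rational.Properties as ℚₚ
import Data.Rational.Unnormalised as ℚᵘ
import Data.Rational.Unnormalised.Properties as ℚᵘₚ
open import Data.Product using (_×_; _,_; proj₁; proj₂)
open import Data.Sum using (inj₁; inj₂)
open import Function using (_∘_; id; mk⇔)
open import Relation.Binary.PropositionalEquality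
open import Relation.Nullary using (yes; no)
open import Relation.Nullary.Decidable using (T?; dec-true; dec-false; does-⇔; isYes; isYes≗does; toWitness)

-- Finite sums

private variable
  ℓ : Level
  A B : Set ℓ

𝟙 : Bool → ℕ
𝟙 true  = 1
𝟙 false = 0

𝟙-∧ : ∀ x y → 𝟙 (x ∧ y) ≡ 𝟙 x * 𝟙 y
𝟙-∧ true  y = sym (+-identityʳ (𝟙 y))
𝟙-∧ false y = refl

≡⇒≡ᵇ-true : ∀ {m n} → m ≡ n → (m ≡ᵇ n) ≡ true
≡⇒≡ᵇ-true = dec-true (_ ≟ _)

≢⇒≡ᵇ-false : ∀ {m n} → m ≢ n → (m ≡ᵇ n) ≡ false
≢⇒≡ᵇ-false = dec-false (_ ≟ _)

<⇒<ᵇ-true : ∀ {m n} → m < n → (m <ᵇ n) ≡ true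
<⇒<ᵇ-true = dec-true (_ <? _)

≮⇒<ᵇ-false : ∀ {m n} → m ≮ n → (m <ᵇ n) ≡ false
≮⇒<ᵇ-false = dec-false (_ <? _)

≡ᵇ-cong-⇔ : ∀ {m n m′ n′} → (m ≡ n → m′ ≡ n′) → (m′ ≡ n′ → m ≡ n) → (m ≡ᵇ n) ≡ (m′ ≡ᵇ n′)
≡ᵇ-cong-⇔ {m} {n} {m′} {n′} to from = does-⇔ (mk⇔ to from) (m ≟ n) (m′ ≟ n′)

≡ᵇ-comm : ∀ m n → (m ≡ᵇ n) ≡ (n ≡ᵇ m)
≡ᵇ-comm m n = ≡ᵇ-cong-⇔ {m} {n} sym sym

∑ˡ : List A → (A → ℕ) → ℕ
∑ˡ []       f = 0
∑ˡ (x ∷ xs) f = f x + ∑ˡ xs f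

∑< : ℕ → (ℕ → ℕ) → ℕ
∑< zero    f = 0
∑< (suc n) f = ∑< n f + f n

infix 6.5 ∑ˡ ∑<
syntax ∑ˡ xs (λ x → e) = ∑[ x ∈ xs ] e
syntax ∑< n (λ c → e) = ∑[ c < n ] e

∑ˡ-cong : ∀ {f g : A → ℕ} xs → (∀ x → f x ≡ g x) → ∑ˡ xs f ≡ ∑ˡ xs g
∑ˡ-cong []       f≗g = refl
∑ˡ-cong (x ∷ xs) f≗g = cong₂ _+_ (f≗g x) (∑ˡ-cong xs f≗g)

∑ˡ-++ : ∀ xs ys (f : A → ℕ) → ∑ˡ (xs ++ ys) f ≡ ∑ˡ xs f + ∑ˡ ys f
∑ˡ-++ []       ys f = refl
∑ˡ-++ (x ∷ xs) ys f = trans (cong (_+_ (f x)) (∑ˡ-++ xs ys f)) (sym (+-assoc (f x) _ _))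

∑ˡ-map : ∀ (g : A → B) xs (f : B → ℕ) → ∑ˡ (map g xs) f ≡ ∑ˡ xs (f ∘ g)
∑ˡ-map g []       f = refl
∑ˡ-map g (x ∷ xs) f = cong (_+_ (f (g x))) (∑ˡ-map g xs f)

∑ˡ-concatMap : ∀ (g : A → List B) xs (f : B → ℕ) →
               ∑ˡ (concatMap g xs) f ≡ ∑[ x ∈ xs ] ∑ˡ (g x) f
∑ˡ-concatMap g []       f = refl
∑ˡ-concatMap g (x ∷ xs) f = trans (∑ˡ-++ (g x) _ f) (cong (_+_ (∑ˡ (g x) f)) (∑ˡ-concatMap g xs f))

∑ˡ-filterᵇ : ∀ (p : A → Bool) xs (f : A → ℕ) → ∑ˡ (filterᵇ p xs) f ≡ ∑[ x ∈ xs ] 𝟙 (p x) * f x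
∑ˡ-filterᵇ p []       f = refl
∑ˡ-filterᵇ p (x ∷ xs) f with p x
... | true  = cong₂ _+_ (sym (+-identityʳ (f x))) (∑ˡ-filterᵇ p xs f)
... | false = ∑ˡ-filterᵇ p xs f

∑ˡ-filterᵇ-cong : ∀ (p : A → Bool) xs {f g : A → ℕ} → (∀ x → p x ≡ true → f x ≡ g x) →
                  ∑ˡ (filterᵇ p xs) f ≡ ∑ˡ (filterᵇ p xs) g
∑ˡ-filterᵇ-cong p xs {f} {g} f≗g =
  trans (∑ˡ-filterᵇ p xs f) (trans (∑ˡ-cong xs pointwise) (sym (∑ˡ-filterᵇ p xs g)))
  where
  pointwise : ∀ x → 𝟙 (p x) * f x ≡ 𝟙 (p x) * g x
  pointwise x with p x in px
  ... | true  = cong (_+ 0) (f≗g x px)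
  ... | false = refl

length≡∑ˡ1 : (xs : List A) → length xs ≡ ∑[ x ∈ xs ] 1
length≡∑ˡ1 []       = refl
length≡∑ˡ1 (x ∷ xs) = cong suc (length≡∑ˡ1 xs)

length-filterᵇ : ∀ (p : A → Bool) xs → length (filterᵇ p xs) ≡ ∑[ x ∈ xs ] 𝟙 (p x)
length-filterᵇ p xs = trans (length≡∑ˡ1 (filterᵇ p xs))
  (trans (∑ˡ-filterᵇ p xs (λ _ → 1)) (∑ˡ-cong xs (λ x → *-identityʳ (𝟙 (p x)))))

∑ˡ-*ˡ : ∀ c xs (f : A → ℕ) → ∑[ x ∈ xs ] c * f x ≡ c * ∑ˡ xs f
∑ˡ-*ˡ c []       f = sym (*-zeroʳ c)
∑ˡ-*ˡ c (x ∷ xs) f = trans (cong (_+_ (c * f x)) (∑ˡ-*ˡ c xs f)) (sym (*-distribˡ-+ c (f x) _))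

∑ˡ-*ʳ : ∀ xs (f : A → ℕ) c → ∑[ x ∈ xs ] f x * c ≡ ∑ˡ xs f * c
∑ˡ-*ʳ []       f c = refl
∑ˡ-*ʳ (x ∷ xs) f c = trans (cong (_+_ (f x * c)) (∑ˡ-*ʳ xs f c)) (sym (*-distribʳ-+ c (f x) _))

∑ˡ-∈-≤ : ∀ {x} {xs : List A} (f : A → ℕ) → x ∈ xs → f x ≤ ∑ˡ xs f
∑ˡ-∈-≤ {xs = y ∷ ys} f (here refl) = m≤m+n (f y) _
∑ˡ-∈-≤ {xs = y ∷ ys} f (there x∈ys) = ≤-trans (∑ˡ-∈-≤ f x∈ys) (m≤n+m _ (f y))

∑<-cong : ∀ n {f g : ℕ → ℕ} → (∀ c → c < n → f c ≡ g c) → ∑< n f ≡ ∑< n g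
∑<-cong zero    f≗g = refl
∑<-cong (suc n) f≗g = cong₂ _+_ (∑<-cong n (λ c c<n → f≗g c (m<n⇒m<1+n c<n))) (f≗g n ≤-refl)

∑<-const : ∀ n k → ∑[ c < n ] k ≡ n * k
∑<-const zero    k = refl
∑<-const (suc n) k = trans (cong (_+ k) (∑<-const n k)) (+-comm (n * k) k)

∑<-zero : ∀ n {f : ℕ → ℕ} → (∀ c → c < n → f c ≡ 0) → ∑< n f ≡ 0
∑<-zero n f≗0 = trans (∑<-cong n f≗0) (trans (∑<-const n 0) (*-zeroʳ n))

∑<-+ : ∀ n (f g : ℕ → ℕ) → ∑[ c < n ] (f c + g c) ≡ ∑< n f + ∑< n g
∑<-+ zero    f g = refl
∑<-+ (suc n) f g = trans (cong (_+ (f n + g n)) (∑<-+ n f g)) (+-+-comm (∑< n f) (∑< n g) (f n) (g n))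
  where
  +-+-comm : ∀ a b c d → a + b + (c + d) ≡ a + c + (b + d)
  +-+-comm = solve-∀

∑<-*ˡ : ∀ n k (f : ℕ → ℕ) → ∑[ c < n ] k * f c ≡ k * ∑< n f
∑<-*ˡ zero    k f = sym (*-zeroʳ k)
∑<-*ˡ (suc n) k f = trans (cong (_+ k * f n) (∑<-*ˡ n k f)) (sym (*-distribˡ-+ k (∑< n f) (f n)))

∑<-shift : ∀ n (f : ℕ → ℕ) → ∑< (suc n) f ≡ f 0 + ∑[ c < n ] f (suc c)
∑<-shift zero    f = +-comm 0 (f 0)
∑<-shift (suc n) f = trans (cong (_+ f (suc n)) (∑<-shift n f)) (+-assoc (f 0) _ _)

∑<-reverse : ∀ n (f : ℕ → ℕ) → ∑< n f ≡ ∑[ c < n ] f (n ∸ suc c)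
∑<-reverse zero    f = refl
∑<-reverse (suc n) f =
  trans (+-comm (∑< n f) (f n)) (trans (cong (_+_ (f n)) (∑<-reverse n f)) (sym (∑<-shift n _)))

∑ˡ-applyUpTo : ∀ (g : ℕ → A) n (f : A → ℕ) → ∑ˡ (applyUpTo g n) f ≡ ∑[ c < n ] f (g c)
∑ˡ-applyUpTo g zero    f = refl
∑ˡ-applyUpTo g (suc n) f = trans (cong (_+_ (f (g 0))) (∑ˡ-applyUpTo (g ∘ suc) n f)) (sym (∑<-shift n (f ∘ g)))

∑ˡ-∑<-comm : ∀ n xs (f : A → ℕ → ℕ) → ∑[ x ∈ xs ] ∑[ c < n ] f x c ≡ ∑[ c < n ] ∑[ x ∈ xs ] f x c
∑ˡ-∑<-comm n []       f = sym (∑<-zero n (λ _ _ → refl))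
∑ˡ-∑<-comm n (x ∷ xs) f = trans (cong (_+_ (∑< n (f x))) (∑ˡ-∑<-comm n xs f)) (sym (∑<-+ n (f x) _))

∑<-pick : ∀ n a (g : ℕ → ℕ) → ∑[ c < n ] 𝟙 (a ≡ᵇ c) * g c ≡ 𝟙 (a <ᵇ n) * g a
∑<-pick zero    a g = refl
∑<-pick (suc n) a g with a ≟ n
... | yes refl = begin
  ∑[ c < a ] 𝟙 (a ≡ᵇ c) * g c + 𝟙 (a ≡ᵇ a) * g a
    ≡⟨ cong₂ _+_ (∑<-pick a a g) (cong (λ b → 𝟙 b * g a) (≡⇒≡ᵇ-true {a} refl)) ⟩
  𝟙 (a <ᵇ a) * g a + 1 * g a
    ≡⟨ cong (λ b → 𝟙 b * g a + 1 * g a) (≮⇒<ᵇ-false {a} (<-irrefl refl)) ⟩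
  1 * g a
    ≡⟨ cong (λ b → 𝟙 b * g a) (<⇒<ᵇ-true {a} ≤-refl) ⟨
  𝟙 (a <ᵇ suc a) * g a                           ∎
  where open ≡-Reasoning
... | no a≢n = begin
  ∑[ c < n ] 𝟙 (a ≡ᵇ c) * g c + 𝟙 (a ≡ᵇ n) * g n
    ≡⟨ cong₂ _+_ (∑<-pick n a g) (cong (λ b → 𝟙 b * g n) (≢⇒≡ᵇ-false a≢n)) ⟩
  𝟙 (a <ᵇ n) * g a + 0
    ≡⟨ +-identityʳ _ ⟩
  𝟙 (a <ᵇ n) * g a
    ≡⟨ cong (λ b → 𝟙 b * g a) (<ᵇ-suc a≢n) ⟩
  𝟙 (a <ᵇ suc n) * g a                           ∎
  where
  open ≡-Reasoning
  <ᵇ-suc : a ≢ n → (a <ᵇ n) ≡ (a <ᵇ suc n)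
  <ᵇ-suc a≢n with a <? n
  ... | yes a<n = trans (<⇒<ᵇ-true a<n) (sym (<⇒<ᵇ-true (m<n⇒m<1+n a<n)))
  ... | no a≮n  = trans (≮⇒<ᵇ-false a≮n) (sym (≮⇒<ᵇ-false (λ a<1+n → a≮n (≤∧≢⇒< (≤-pred a<1+n) a≢n))))

∑<-pick-< : ∀ {n a} (g : ℕ → ℕ) → a < n → ∑[ c < n ] 𝟙 (a ≡ᵇ c) * g c ≡ g a
∑<-pick-< {n} {a} g a<n =
  trans (∑<-pick n a g) (trans (cong (λ b → 𝟙 b * g a) (<⇒<ᵇ-true a<n)) (*-identityˡ (g a)))

∑<-pickʳ : ∀ n j (g : ℕ → ℕ) → ∑[ c < n ] 𝟙 (c ≡ᵇ j) * g c ≡ 𝟙 (j <ᵇ n) * g j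
∑<-pickʳ n j g = trans (∑<-cong n (λ c _ → cong (λ b → 𝟙 b * g c) (≡ᵇ-comm c j))) (∑<-pick n j g)

∑<-count-< : ∀ n p → ∑[ c < n ] 𝟙 (c <ᵇ p) ≡ n ⊓ p
∑<-count-< zero    p = refl
∑<-count-< (suc n) p with n <? p
... | yes n<p rewrite <⇒<ᵇ-true n<p | ∑<-count-< n p
                    | m≤n⇒m⊓n≡m (<⇒≤ n<p) | m≤n⇒m⊓n≡m n<p = +-comm n 1
... | no n≮p  rewrite ≮⇒<ᵇ-false n≮p | ∑<-count-< n p
                    | m≥n⇒m⊓n≡n (≮⇒≥ n≮p) | m≥n⇒m⊓n≡n (m≤n⇒m≤1+n (≮⇒≥ n≮p)) = +-identityʳ p

∸-suc-step : ∀ n q → n ∸ suc q + 𝟙 (q <ᵇ n) ≡ n ∸ q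
∸-suc-step n q with q <? n
... | yes q<n rewrite <⇒<ᵇ-true q<n = trans (+-comm _ 1) (sym (+-∸-assoc 1 q<n))
... | no q≮n  rewrite ≮⇒<ᵇ-false q≮n
                    | m≤n⇒m∸n≡0 (≮⇒≥ q≮n) | m≤n⇒m∸n≡0 (m≤n⇒m≤1+n (≮⇒≥ q≮n)) = refl

∑<-count-> : ∀ n q → ∑[ c < n ] 𝟙 (q <ᵇ c) ≡ n ∸ suc q
∑<-count-> zero    q = refl
∑<-count-> (suc n) q = trans (cong (_+ 𝟙 (q <ᵇ n)) (∑<-count-> n q)) (∸-suc-step n q)

∑<-count-between : ∀ n p q → ∑[ c < n ] 𝟙 ((p <ᵇ c) ∧ (c <ᵇ q)) ≡ n ⊓ q ∸ suc p
∑<-count-between zero    p q = refl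
∑<-count-between (suc n) p q rewrite ∑<-count-between n p q with n <? q
... | yes n<q rewrite <⇒<ᵇ-true n<q | ∧-identityʳ (p <ᵇ n)
                    | m≤n⇒m⊓n≡m (<⇒≤ n<q) | m≤n⇒m⊓n≡m n<q = ∸-suc-step n p
... | no n≮q  rewrite ≮⇒<ᵇ-false n≮q | ∧-zeroʳ (p <ᵇ n)
                    | m≥n⇒m⊓n≡n (≮⇒≥ n≮q) | m≥n⇒m⊓n≡n (m≤n⇒m≤1+n (≮⇒≥ n≮q)) = +-identityʳ _

∑<-count-≡ : ∀ a j → ∑[ b < a ] 𝟙 (b ≡ᵇ j) ≡ 𝟙 (j <ᵇ a)
∑<-count-≡ a j = trans (∑<-cong a (λ b _ → sym (*-identityʳ _))) (trans (∑<-pickʳ a j (λ _ → 1)) (*-identityʳ _))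

∑<-≡0⇒ : ∀ n {f : ℕ → ℕ} → ∑< n f ≡ 0 → ∀ c → c < n → f c ≡ 0
∑<-≡0⇒ (suc n) {f} ∑≡0 c c<1+n with m<1+n⇒m<n∨m≡n c<1+n
... | inj₁ c<n  = ∑<-≡0⇒ n (m+n≡0⇒m≡0 (∑< n f) ∑≡0) c c<n
... | inj₂ refl = m+n≡0⇒n≡0 (∑< n f) ∑≡0

∑<-tight : ∀ n (f : ℕ → ℕ) → (∀ c → c < n → f c ≤ 1) → ∑< n f ≡ n → ∀ c → c < n → f c ≡ 1
∑<-tight n f f≤1 ∑f≡n c c<n = ≤-antisym (f≤1 c c<n) (m∸n≡0⇒m≤n (∑<-≡0⇒ n ∑[1∸f]≡0 c c<n))
  where
  open ≡-Reasoning
  ∑[1∸f]≡0 : ∑[ c < n ] (1 ∸ f c) ≡ 0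
  ∑[1∸f]≡0 = +-cancelˡ-≡ n _ 0 (begin
    n + ∑[ c < n ] (1 ∸ f c)           ≡⟨ cong (_+ ∑[ c < n ] (1 ∸ f c)) ∑f≡n ⟨
    ∑< n f + ∑[ c < n ] (1 ∸ f c)      ≡⟨ ∑<-+ n f (λ c → 1 ∸ f c) ⟨
    ∑[ c < n ] (f c + (1 ∸ f c))       ≡⟨ ∑<-cong n (λ c c<n → m+[n∸m]≡n (f≤1 c c<n)) ⟩
    ∑[ c < n ] 1                       ≡⟨ ∑<-const n 1 ⟩
    n * 1                              ≡⟨ *-identityʳ n ⟩
    n                                  ≡⟨ +-identityʳ n ⟨
    n + 0                              ∎)

-- Enumerations of [0, n)

multiplicity : ℕ → List ℕ → ℕ
multiplicity c xs = ∑[ x ∈ xs ] 𝟙 (x ≡ᵇ c)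

multiplicity-∉ : ∀ c xs → All (c ≢_) xs → multiplicity c xs ≡ 0
multiplicity-∉ c []       []            = refl
multiplicity-∉ c (x ∷ xs) (c≢x ∷ c∉xs) rewrite ≢⇒≡ᵇ-false (c≢x ∘ sym) = multiplicity-∉ c xs c∉xs

multiplicity-unique : ∀ c xs → Unique xs → multiplicity c xs ≤ 1
multiplicity-unique c []       []            = z≤n
multiplicity-unique c (x ∷ xs) (x∉xs ∷ uxs) with x ≟ c
... | yes refl rewrite ≡⇒≡ᵇ-true {x} refl | multiplicity-∉ x xs x∉xs = ≤-refl
... | no x≢c   rewrite ≢⇒≡ᵇ-false x≢c = multiplicity-unique c xs uxs

∑ˡ-by-multiplicity : ∀ n xs → All (_< n) xs → (g : ℕ → ℕ) → ∑ˡ xs g ≡ ∑[ c < n ] multiplicity c xs * g c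
∑ˡ-by-multiplicity n []       []              g = sym (∑<-zero n (λ _ _ → refl))
∑ˡ-by-multiplicity n (x ∷ xs) (x<n ∷ xs<n) g = sym (begin
  ∑[ c < n ] (𝟙 (x ≡ᵇ c) + multiplicity c xs) * g c
    ≡⟨ ∑<-cong n (λ c _ → *-distribʳ-+ (g c) (𝟙 (x ≡ᵇ c)) _) ⟩
  ∑[ c < n ] (𝟙 (x ≡ᵇ c) * g c + multiplicity c xs * g c)
    ≡⟨ ∑<-+ n _ _ ⟩
  ∑[ c < n ] 𝟙 (x ≡ᵇ c) * g c + ∑[ c < n ] multiplicity c xs * g c
    ≡⟨ cong₂ _+_ (∑<-pick-< g x<n) (sym (∑ˡ-by-multiplicity n xs xs<n g)) ⟩
  g x + ∑ˡ xs g ∎)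
  where open ≡-Reasoning

∑ˡ-enumeration : ∀ n xs → Unique xs → All (_< n) xs → length xs ≡ n → (g : ℕ → ℕ) → ∑ˡ xs g ≡ ∑< n g
∑ˡ-enumeration n xs uxs xs<n |xs|≡n g =
  trans (∑ˡ-by-multiplicity n xs xs<n g)
        (∑<-cong n (λ c c<n → trans (cong (_* g c) (once c c<n)) (*-identityˡ (g c))))
  where
  total : ∑[ c < n ] multiplicity c xs ≡ n
  total = begin
    ∑[ c < n ] multiplicity c xs       ≡⟨ ∑<-cong n (λ c _ → *-identityʳ (multiplicity c xs)) ⟨
    ∑[ c < n ] multiplicity c xs * 1   ≡⟨ ∑ˡ-by-multiplicity n xs xs<n (λ _ → 1) ⟨
    ∑[ x ∈ xs ] 1                      ≡⟨ length≡∑ˡ1 xs ⟨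
    length xs                          ≡⟨ |xs|≡n ⟩
    n                                  ∎
    where open ≡-Reasoning
  once : ∀ c → c < n → multiplicity c xs ≡ 1
  once = ∑<-tight n (λ c → multiplicity c xs) (λ c _ → multiplicity-unique c xs uxs) total

-- S, M and L as functions of the endpoint values

count-init : ∀ {m} (P : ℕ → Bool) x (v : Vec ℕ (suc m)) → P x ≡ false → P (Vec.last v) ≡ false →
             count P (Vec.init v) ≡ ∑[ c ∈ Vec.toList (x ∷ v) ] 𝟙 (P c)
count-init P x v Px≡false Plast≡false = begin
  count P (Vec.init v)
    ≡⟨ length-filterᵇ P (Vec.toList (Vec.init v)) ⟩
  ∑ˡ (Vec.toList (Vec.init v)) (𝟙 ∘ P)
    ≡⟨ +-identityʳ _ ⟨
  ∑ˡ (Vec.toList (Vec.init v)) (𝟙 ∘ P) + 0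
    ≡⟨ cong (λ b → ∑ˡ (Vec.toList (Vec.init v)) (𝟙 ∘ P) + (𝟙 b + 0)) Plast≡false ⟨
  ∑ˡ (Vec.toList (Vec.init v)) (𝟙 ∘ P) + ∑ˡ (Vec.last v ∷ []) (𝟙 ∘ P)
    ≡⟨ ∑ˡ-++ (Vec.toList (Vec.init v)) _ (𝟙 ∘ P) ⟨
  ∑ˡ (Vec.toList (Vec.init v) ++ Vec.last v ∷ []) (𝟙 ∘ P)
    ≡⟨ cong (λ xs → ∑ˡ xs (𝟙 ∘ P)) (Vecₚ.toList-∷ʳ (Vec.last v) (Vec.init v)) ⟨
  ∑ˡ (Vec.toList (Vec.init v Vec.∷ʳ Vec.last v)) (𝟙 ∘ P)
    ≡⟨ cong (λ u → ∑ˡ (Vec.toList u) (𝟙 ∘ P)) (proj₂ (proj₂ (Vec.initLast v))) ⟨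
  ∑ˡ (Vec.toList v) (𝟙 ∘ P)
    ≡⟨ cong (λ b → 𝟙 b + ∑ˡ (Vec.toList v) (𝟙 ∘ P)) Px≡false ⟨
  ∑ˡ (Vec.toList (x ∷ v)) (𝟙 ∘ P) ∎
  where open ≡-Reasoning

last-map : ∀ {m} (f : A → B) (v : Vec A (suc m)) → Vec.last (Vec.map f v) ≡ f (Vec.last v)
last-map f (x ∷ [])     = refl
last-map f (x ∷ y ∷ ys) = last-map f (y ∷ ys)

All-last : ∀ {m} {P : A → Set ℓ} (v : Vec A (suc m)) → All P (Vec.toList v) → P (Vec.last v)
All-last (x ∷ [])     (px ∷ [])  = px
All-last (x ∷ y ∷ ys) (_ ∷ pys) = All-last (y ∷ ys) pys

endpointStats : ℕ → ℕ → ℕ → ℕ × ℕ × ℕ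
endpointStats n a b = a ⊓ b , a ⊔ b ∸ suc (a ⊓ b) , n ∸ suc (a ⊔ b)

strictly-between-⊓-⊔ : ℕ → ℕ → ℕ → Bool
strictly-between-⊓-⊔ a b c = (a ⊓ b <ᵇ c) ∧ (c <ᵇ a ⊔ b)

endpoints-not-strictly-between : ∀ a b →
                                 strictly-between-⊓-⊔ a b a ≡ false × strictly-between-⊓-⊔ a b b ≡ false
endpoints-not-strictly-between a b with ≤-total a b
... | inj₁ a≤b rewrite m≤n⇒m⊓n≡m a≤b | m≤n⇒m⊔n≡n a≤b
                     | ≮⇒<ᵇ-false {a} (<-irrefl refl) | ≮⇒<ᵇ-false {b} (<-irrefl refl) =
  refl , ∧-zeroʳ (a <ᵇ b)
... | inj₂ b≤a rewrite m≥n⇒m⊓n≡n b≤a | m≥n⇒m⊔n≡m b≤a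
                     | ≮⇒<ᵇ-false {a} (<-irrefl refl) | ≮⇒<ᵇ-false {b} (<-irrefl refl) =
  ∧-zeroʳ (b <ᵇ a) , refl

SML′-endpoints : ∀ {n} (w : Vec ℕ (2+ n)) → Unique (Vec.toList w) → All (_< 2+ n) (Vec.toList w) →
                 SML′ w ≡ endpointStats (2+ n) (Vec.head w) (Vec.last w)
SML′-endpoints {n} w@(a ∷ v@(_ ∷ _)) uw w<n@(a<2+n ∷ v<2+n) = cong₂ _,_ S≡ (cong₂ _,_ M≡ L≡)
  where
  b = Vec.last v
  b<2+n : b < 2+ n
  b<2+n = All-last v v<2+n
  count-init≡∑< : ∀ (P : ℕ → Bool) → P a ≡ false → P b ≡ false → count P (Vec.init v) ≡ ∑[ c < 2+ n ] 𝟙 (P c)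
  count-init≡∑< P Pa Pb =
    trans (count-init P a v Pa Pb) (∑ˡ-enumeration (2+ n) (Vec.toList w) uw w<n (Vecₚ.length-toList w) (𝟙 ∘ P))
  S≡ : count (λ c → c <ᵇ a ⊓ b) (Vec.init v) ≡ a ⊓ b
  S≡ = begin
    count (λ c → c <ᵇ a ⊓ b) (Vec.init v)
      ≡⟨ count-init≡∑< _ (≮⇒<ᵇ-false (≤⇒≯ (m⊓n≤m a b))) (≮⇒<ᵇ-false (≤⇒≯ (m⊓n≤n a b))) ⟩
    ∑[ c < 2+ n ] 𝟙 (c <ᵇ a ⊓ b)
      ≡⟨ ∑<-count-< (2+ n) (a ⊓ b) ⟩
    2+ n ⊓ (a ⊓ b)
      ≡⟨ m≥n⇒m⊓n≡n (<⇒≤ (≤-<-trans (m⊓n≤m a b) a<2+n)) ⟩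
    a ⊓ b                                 ∎
    where open ≡-Reasoning
  M≡ : count (strictly-between-⊓-⊔ a b) (Vec.init v) ≡ a ⊔ b ∸ suc (a ⊓ b)
  M≡ = begin
    count (strictly-between-⊓-⊔ a b) (Vec.init v)
      ≡⟨ count-init≡∑< _ (proj₁ (endpoints-not-strictly-between a b)) (proj₂ (endpoints-not-strictly-between a b)) ⟩
    ∑[ c < 2+ n ] 𝟙 (strictly-between-⊓-⊔ a b c)
      ≡⟨ ∑<-count-between (2+ n) (a ⊓ b) (a ⊔ b) ⟩
    2+ n ⊓ (a ⊔ b) ∸ suc (a ⊓ b)
      ≡⟨ cong (_∸ suc (a ⊓ b)) (m≥n⇒m⊓n≡n (<⇒≤ (⊔-lub a<2+n b<2+n))) ⟩
    a ⊔ b ∸ suc (a ⊓ b) ∎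
    where open ≡-Reasoning
  L≡ : count (λ c → a ⊔ b <ᵇ c) (Vec.init v) ≡ 2+ n ∸ suc (a ⊔ b)
  L≡ = trans (count-init≡∑< _ (≮⇒<ᵇ-false (≤⇒≯ (m≤m⊔n a b))) (≮⇒<ᵇ-false (≤⇒≯ (m≤n⊔m a b))))
             (∑<-count-> (2+ n) (a ⊔ b))

SML-endpoints : ∀ {n} (ω : Vec (Fin (2+ n)) (2+ n)) → Unique (Vec.toList ω) →
                SML ω ≡ endpointStats (2+ n) (toℕ (Vec.head ω)) (toℕ (Vec.last ω))
SML-endpoints {n} ω@(_ ∷ _) uω = begin
  SML′ (Vec.map toℕ ω)
    ≡⟨ SML′-endpoints (Vec.map toℕ ω) unique-values (values<n ω) ⟩
  endpointStats (2+ n) (toℕ (Vec.head ω)) (Vec.last (Vec.map toℕ ω))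
    ≡⟨ cong (endpointStats (2+ n) (toℕ (Vec.head ω))) (last-map toℕ ω) ⟩
  endpointStats (2+ n) (toℕ (Vec.head ω)) (toℕ (Vec.last ω))      ∎
  where
  open ≡-Reasoning
  unique-values : Unique (Vec.toList (Vec.map toℕ ω))
  unique-values = subst Unique (sym (Vecₚ.toList-map toℕ ω)) (Uniqueₚ.map⁺ Finₚ.toℕ-injective uω)
  values<n : ∀ {m} (v : Vec (Fin (2+ n)) m) → All (_< 2+ n) (Vec.toList (Vec.map toℕ v))
  values<n []      = []
  values<n (x ∷ v) = Finₚ.toℕ<n x ∷ values<n v

endpointStats-comm : ∀ n a b → endpointStats n a b ≡ endpointStats n b a
endpointStats-comm n a b rewrite ⊓-comm a b | ⊔-comm a b = refl

endpointStats-ordered : ∀ n {a b} → b < a → endpointStats n b a ≡ (b , a ∸ suc b , n ∸ suc a)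
endpointStats-ordered n b<a rewrite m≤n⇒m⊓n≡m (<⇒≤ b<a) | m≤n⇒m⊔n≡n (<⇒≤ b<a) = refl

-- Relabelling the values of an ordering

∑ˡ-allFin-permute : ∀ {n} (π : Permutation n n) (h : Fin n → ℕ) →
                    ∑ˡ (allFin n) h ≡ ∑[ i ∈ allFin n ] h (π ⟨$⟩ʳ i)
∑ˡ-allFin-permute π h =
  trans (∑ˡ-tabulate id h) (trans (sum-permute h π) (sym (∑ˡ-tabulate id (h ∘ (π ⟨$⟩ʳ_)))))
  where
  ∑ˡ-tabulate : ∀ {m} (g : Fin m → A) (f : A → ℕ) → ∑ˡ (List.tabulate g) f ≡ sum (f ∘ g)
  ∑ˡ-tabulate {m = zero}  g f = refl
  ∑ˡ-tabulate {m = suc m} g f = cong (_+_ (f (g Fin.zero))) (∑ˡ-tabulate (g ∘ Fin.suc) f)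

∑ˡ-allVecs-suc : ∀ (xs : List A) m (H : Vec A (suc m) → ℕ) →
                 ∑ˡ (allVecs xs (suc m)) H ≡ ∑[ x ∈ xs ] ∑[ v ∈ allVecs xs m ] H (x ∷ v)
∑ˡ-allVecs-suc xs m H = trans (∑ˡ-concatMap _ xs H) (∑ˡ-cong xs (λ x → ∑ˡ-map (x ∷_) (allVecs xs m) H))

∑ˡ-allVecs-map : ∀ (f : A → A) xs → (∀ (h : A → ℕ) → ∑ˡ xs h ≡ ∑[ x ∈ xs ] h (f x)) →
                 ∀ m (H : Vec A m → ℕ) → ∑ˡ (allVecs xs m) H ≡ ∑[ v ∈ allVecs xs m ] H (Vec.map f v)
∑ˡ-allVecs-map f xs f-invariant zero    H = refl
∑ˡ-allVecs-map f xs f-invariant (suc m) H = begin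
  ∑ˡ (allVecs xs (suc m)) H
    ≡⟨ ∑ˡ-allVecs-suc xs m H ⟩
  ∑[ x ∈ xs ] ∑[ v ∈ allVecs xs m ] H (x ∷ v)
    ≡⟨ ∑ˡ-cong xs (λ x → ∑ˡ-allVecs-map f xs f-invariant m (H ∘ (x ∷_))) ⟩
  ∑[ x ∈ xs ] ∑[ v ∈ allVecs xs m ] H (x ∷ Vec.map f v)
    ≡⟨ f-invariant (λ x → ∑[ v ∈ allVecs xs m ] H (x ∷ Vec.map f v)) ⟩
  ∑[ x ∈ xs ] ∑[ v ∈ allVecs xs m ] H (f x ∷ Vec.map f v)
    ≡⟨ ∑ˡ-allVecs-suc xs m (H ∘ Vec.map f) ⟨
  ∑[ v ∈ allVecs xs (suc m) ] H (Vec.map f v)                   ∎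
  where open ≡-Reasoning

∈-allVecs-allFin : ∀ {n} m (v : Vec (Fin n) m) → v ∈ allVecs (allFin n) m
∈-allVecs-allFin zero    []      = here refl
∈-allVecs-allFin (suc m) (x ∷ v) =
  ∈ₚ.∈-concatMap⁺ (λ y → map (y ∷_) (allVecs (allFin _) m))
    (Any.map (λ { refl → ∈ₚ.∈-map⁺ (x ∷_) (∈-allVecs-allFin m v) }) (∈ₚ.∈-allFin x))

isOrdering : ∀ {n} → Vec (Fin n) n → Bool
isOrdering ω = isYes (UniqueDec.unique? Finₚ._≟_ (Vec.toList ω))

isOrdering⇒Unique : ∀ {n} (ω : Vec (Fin n) n) → isOrdering ω ≡ true → Unique (Vec.toList ω)
isOrdering⇒Unique ω isω = toWitness (subst T (sym isω) _)

∑Ω-cong : ∀ {n} {G H : Vec (Fin n) n → ℕ} → (∀ ω → Unique (Vec.toList ω) → G ω ≡ H ω) →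
          ∑ˡ (Ω n) G ≡ ∑ˡ (Ω n) H
∑Ω-cong {n} G≗H =
  ∑ˡ-filterᵇ-cong isOrdering (allVecs (allFin n) n) (λ ω isω → G≗H ω (isOrdering⇒Unique ω isω))

isOrdering-permute : ∀ {n} (π : Permutation n n) ω → isOrdering (Vec.map (π ⟨$⟩ʳ_) ω) ≡ isOrdering ω
isOrdering-permute π ω =
  trans (isYes≗does (unique? _))
        (trans (does-⇔ (mk⇔ to from) (unique? _) (unique? _)) (sym (isYes≗does (unique? _))))
  where
  unique? = UniqueDec.unique? Finₚ._≟_
  to : Unique (Vec.toList (Vec.map (π ⟨$⟩ʳ_) ω)) → Unique (Vec.toList ω)
  to u = Uniqueₚ.map⁻ (subst Unique (Vecₚ.toList-map (π ⟨$⟩ʳ_) ω) u)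
  from : Unique (Vec.toList ω) → Unique (Vec.toList (Vec.map (π ⟨$⟩ʳ_) ω))
  from u = subst Unique (sym (Vecₚ.toList-map (π ⟨$⟩ʳ_) ω))
    (Uniqueₚ.map⁺ (λ πx≡πy → trans (sym (Perm.inverseˡ π)) (trans (cong (π ⟨$⟩ˡ_) πx≡πy) (Perm.inverseˡ π)))
                  u)

∑Ω-permute : ∀ {n} (π : Permutation n n) (G : Vec (Fin n) n → ℕ) →
             ∑ˡ (Ω n) G ≡ ∑[ ω ∈ Ω n ] G (Vec.map (π ⟨$⟩ʳ_) ω)
∑Ω-permute {n} π G = begin
  ∑ˡ (filterᵇ isOrdering Vs) G
    ≡⟨ ∑ˡ-filterᵇ isOrdering Vs G ⟩
  ∑[ v ∈ Vs ] 𝟙 (isOrdering v) * G v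
    ≡⟨ ∑ˡ-allVecs-map (π ⟨$⟩ʳ_) (allFin n) (∑ˡ-allFin-permute π) n _ ⟩
  ∑[ v ∈ Vs ] 𝟙 (isOrdering (πv v)) * G (πv v)
    ≡⟨ ∑ˡ-cong Vs (λ v → cong (λ b → 𝟙 b * G (πv v)) (isOrdering-permute π v)) ⟩
  ∑[ v ∈ Vs ] 𝟙 (isOrdering v) * G (πv v)
    ≡⟨ ∑ˡ-filterᵇ isOrdering Vs (G ∘ πv) ⟨
  ∑[ ω ∈ filterᵇ isOrdering Vs ] G (πv ω)                         ∎
  where
  open ≡-Reasoning
  Vs = allVecs (allFin n) n
  πv = Vec.map (π ⟨$⟩ʳ_)

Unique-allFin : ∀ n → Unique (Vec.toList (Vec.allFin n))
Unique-allFin n = subst Unique (sym (toList-tabulate id)) (Uniqueₚ.allFin⁺ n)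
  where
  toList-tabulate : ∀ {m} (f : Fin m → A) → Vec.toList (Vec.tabulate f) ≡ List.tabulate f
  toList-tabulate {m = zero}  f = refl
  toList-tabulate {m = suc m} f = cong (f Fin.zero ∷_) (toList-tabulate (f ∘ Fin.suc))

allFin∈Ω : ∀ n → Vec.allFin n ∈ Ω n
allFin∈Ω n = ∈ₚ.∈-filter⁺ (T? ∘ isOrdering) (∈-allVecs-allFin n (Vec.allFin n))
  (subst T (sym (trans (isYes≗does _) (dec-true (UniqueDec.unique? Finₚ._≟_ _) (Unique-allFin n)))) _)

ordering-head≢last : ∀ {n} (ω : Vec (Fin (2+ n)) (2+ n)) → Unique (Vec.toList ω) → Vec.head ω ≢ Vec.last ω
ordering-head≢last (x ∷ v) (x∉v ∷ _) = All-last v x∉v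

endpointCount : ∀ n → ℕ → ℕ → ℕ
endpointCount n a b = ∑[ ω ∈ Ω (suc n) ] 𝟙 (toℕ (Vec.head ω) ≡ᵇ a) * 𝟙 (toℕ (Vec.last ω) ≡ᵇ b)

toℕ-≡ᵇ-permute : ∀ {n} (π : Permutation n n) u x →
                 (toℕ (π ⟨$⟩ʳ u) ≡ᵇ toℕ x) ≡ (toℕ u ≡ᵇ toℕ (π ⟨$⟩ˡ x))
toℕ-≡ᵇ-permute π u x = ≡ᵇ-cong-⇔ to from
  where
  to : toℕ (π ⟨$⟩ʳ u) ≡ toℕ x → toℕ u ≡ toℕ (π ⟨$⟩ˡ x)
  to eq = cong toℕ (trans (sym (Perm.inverseˡ π)) (cong (π ⟨$⟩ˡ_) (Finₚ.toℕ-injective eq)))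
  from : toℕ u ≡ toℕ (π ⟨$⟩ˡ x) → toℕ (π ⟨$⟩ʳ u) ≡ toℕ x
  from eq = cong toℕ (trans (cong (π ⟨$⟩ʳ_) (Finₚ.toℕ-injective eq)) (Perm.inverseʳ π))

endpointCount-permute : ∀ {n} (π : Permutation (suc n) (suc n)) x y →
                        endpointCount n (toℕ x) (toℕ y) ≡ endpointCount n (toℕ (π ⟨$⟩ˡ x)) (toℕ (π ⟨$⟩ˡ y))
endpointCount-permute {n} π x y = trans (∑Ω-permute π _) (∑ˡ-cong (Ω (suc n)) pointwise)
  where
  pointwise : ∀ ω →
              𝟙 (toℕ (Vec.head (Vec.map (π ⟨$⟩ʳ_) ω)) ≡ᵇ toℕ x) * 𝟙 (toℕ (Vec.last (Vec.map (π ⟨$⟩ʳ_) ω)) ≡ᵇ toℕ y)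
              ≡ 𝟙 (toℕ (Vec.head ω) ≡ᵇ toℕ (π ⟨$⟩ˡ x)) * 𝟙 (toℕ (Vec.last ω) ≡ᵇ toℕ (π ⟨$⟩ˡ y))
  pointwise ω@(u ∷ _) rewrite last-map (π ⟨$⟩ʳ_) ω =
    cong₂ (λ p q → 𝟙 p * 𝟙 q) (toℕ-≡ᵇ-permute π u x) (toℕ-≡ᵇ-permute π (Vec.last ω) y)

transpose-here : ∀ {n} (i j : Fin n) → PermC.transpose i j i ≡ j
transpose-here i j rewrite dec-true (i Fin.≟ i) refl = refl

transpose-elsewhere : ∀ {n} (i j k : Fin n) → k ≢ i → k ≢ j → PermC.transpose i j k ≡ k
transpose-elsewhere i j k k≢i k≢j rewrite dec-false (k Fin.≟ i) k≢i | dec-false (k Fin.≟ j) k≢j = refl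

endpointCount-off-diagonal : ∀ {n} (x y : Fin (2+ n)) → x ≢ y →
                             endpointCount (suc n) (toℕ x) (toℕ y) ≡ endpointCount (suc n) 0 1
endpointCount-off-diagonal {n} x y x≢y = begin
  endpointCount (suc n) (toℕ x) (toℕ y)
    ≡⟨ endpointCount-permute (Perm.transpose 0F x) x y ⟩
  endpointCount (suc n) (toℕ (PermC.transpose x 0F x)) (toℕ y′)
    ≡⟨ cong (λ z → endpointCount (suc n) (toℕ z) (toℕ y′)) (transpose-here x 0F) ⟩
  endpointCount (suc n) 0 (toℕ y′)
    ≡⟨ endpointCount-permute (Perm.transpose 1F y′) 0F y′ ⟩
  endpointCount (suc n) (toℕ (PermC.transpose y′ 1F 0F)) (toℕ (PermC.transpose y′ 1F y′))
    ≡⟨ cong₂ (λ z w → endpointCount (suc n) (toℕ z) (toℕ w))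
             (transpose-elsewhere y′ 1F 0F (y′≢0 ∘ sym) (λ ())) (transpose-here y′ 1F) ⟩
  endpointCount (suc n) 0 1 ∎
  where
  open ≡-Reasoning
  0F 1F : Fin (2+ n)
  0F = Fin.zero
  1F = Fin.suc Fin.zero
  y′ = PermC.transpose x 0F y
  y′≢0 : y′ ≢ 0F
  y′≢0 y′≡0 = x≢y (sym (trans (sym (PermC.transpose-inverse 0F x))
                       (trans (cong (PermC.transpose 0F x) (trans y′≡0 (sym (transpose-here x 0F))))
                              (PermC.transpose-inverse 0F x))))

endpointCount-diagonal : ∀ {n} a → endpointCount (suc n) a a ≡ 0
endpointCount-diagonal {n} a = trans (∑Ω-cong {2+ n} pointwise) (∑ˡ-*ˡ 0 (Ω (2+ n)) (λ _ → 0))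
  where
  pointwise : ∀ (ω : Vec (Fin (2+ n)) (2+ n)) → Unique (Vec.toList ω) →
              𝟙 (toℕ (Vec.head ω) ≡ᵇ a) * 𝟙 (toℕ (Vec.last ω) ≡ᵇ a) ≡ 0 * 0
  pointwise ω uω with toℕ (Vec.head ω) ≟ a
  ... | yes h≡a rewrite ≡⇒≡ᵇ-true h≡a
                      | ≢⇒≡ᵇ-false (λ l≡a → ordering-head≢last ω uω (Finₚ.toℕ-injective (trans h≡a (sym l≡a)))) = refl
  ... | no h≢a   rewrite ≢⇒≡ᵇ-false h≢a = refl

-- The number of orderings of 2 + k values that start with 0 and end with 1; it is k!, but only its
-- positivity is used.
c₀ : ℕ → ℕ
c₀ k = endpointCount (suc k) 0 1

endpointCount-value : ∀ {k a b} → a < 2+ k → b < 2+ k → endpointCount (suc k) a b ≡ 𝟙 (not (a ≡ᵇ b)) * c₀ k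
endpointCount-value {k} {a} {b} a<n b<n with a ≟ b
... | yes refl rewrite ≡⇒≡ᵇ-true {a} refl = endpointCount-diagonal {k} a
... | no a≢b   rewrite ≢⇒≡ᵇ-false a≢b =
  trans (cong₂ (endpointCount (suc k)) (sym (Finₚ.toℕ-fromℕ< a<n)) (sym (Finₚ.toℕ-fromℕ< b<n)))
        (trans (endpointCount-off-diagonal _ _ (a≢b ∘ Finₚ.fromℕ<-injective a b a<n b<n)) (sym (+-identityʳ (c₀ k))))

c₀-positive : ∀ k → 0 < c₀ k
c₀-positive k = begin-strict
  0
    <⟨ ℕ.z<s ⟩
  1 * 1
    ≡⟨ cong (λ b → 1 * 𝟙 b) (≡⇒≡ᵇ-true {toℕ y} refl) ⟨
  𝟙 (toℕ x ≡ᵇ toℕ x) * 𝟙 (toℕ y ≡ᵇ toℕ y)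
    ≤⟨ ∑ˡ-∈-≤ (λ ω → 𝟙 (toℕ (Vec.head ω) ≡ᵇ toℕ x) * 𝟙 (toℕ (Vec.last ω) ≡ᵇ toℕ y))
              (allFin∈Ω (2+ k)) ⟩
  endpointCount (suc k) (toℕ x) (toℕ y)
    ≡⟨ endpointCount-off-diagonal x y (ordering-head≢last ω₀ (Unique-allFin (2+ k))) ⟩
  c₀ k                                     ∎
  where
  open ≤-Reasoning
  ω₀ = Vec.allFin (2+ k)
  x = Vec.head ω₀
  y = Vec.last ω₀

∑Ω-endpoints : ∀ k (F : ℕ → ℕ → ℕ) →
               ∑[ ω ∈ Ω (2+ k) ] F (toℕ (Vec.head ω)) (toℕ (Vec.last ω))
               ≡ c₀ k * (∑[ a < 2+ k ] ∑[ b < 2+ k ] 𝟙 (not (a ≡ᵇ b)) * F a b)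
∑Ω-endpoints k F = begin
  ∑[ ω ∈ Ωₙ ] F (hd ω) (lt ω)
    ≡⟨ ∑ˡ-cong Ωₙ (λ ω → sym (pick-endpoints ω)) ⟩
  ∑[ ω ∈ Ωₙ ] ∑[ a < n ] ∑[ b < n ] 𝟙 (hd ω ≡ᵇ a) * (𝟙 (lt ω ≡ᵇ b) * F a b)
    ≡⟨ ∑ˡ-∑<-comm n Ωₙ _ ⟩
  ∑[ a < n ] ∑[ ω ∈ Ωₙ ] ∑[ b < n ] 𝟙 (hd ω ≡ᵇ a) * (𝟙 (lt ω ≡ᵇ b) * F a b)
    ≡⟨ ∑<-cong n (λ a _ → ∑ˡ-∑<-comm n Ωₙ _) ⟩
  ∑[ a < n ] ∑[ b < n ] ∑[ ω ∈ Ωₙ ] 𝟙 (hd ω ≡ᵇ a) * (𝟙 (lt ω ≡ᵇ b) * F a b)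
    ≡⟨ ∑<-cong n (λ a _ → ∑<-cong n (λ b _ →
         trans (∑ˡ-cong Ωₙ (λ ω → sym (*-assoc (𝟙 (hd ω ≡ᵇ a)) _ _))) (∑ˡ-*ʳ Ωₙ _ (F a b)))) ⟩
  ∑[ a < n ] ∑[ b < n ] endpointCount (suc k) a b * F a b
    ≡⟨ ∑<-cong n (λ a a<n → ∑<-cong n (λ b b<n → cong (_* F a b) (endpointCount-value a<n b<n))) ⟩
  ∑[ a < n ] ∑[ b < n ] 𝟙 (not (a ≡ᵇ b)) * c₀ k * F a b
    ≡⟨ ∑<-cong n (λ a _ → ∑<-cong n (λ b _ → swap-c₀ (𝟙 (not (a ≡ᵇ b))) (c₀ k) (F a b))) ⟩
  ∑[ a < n ] ∑[ b < n ] c₀ k * (𝟙 (not (a ≡ᵇ b)) * F a b)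
    ≡⟨ ∑<-cong n (λ a _ → ∑<-*ˡ n (c₀ k) _) ⟩
  ∑[ a < n ] c₀ k * (∑[ b < n ] 𝟙 (not (a ≡ᵇ b)) * F a b)
    ≡⟨ ∑<-*ˡ n (c₀ k) _ ⟩
  c₀ k * (∑[ a < n ] ∑[ b < n ] 𝟙 (not (a ≡ᵇ b)) * F a b) ∎
  where
  open ≡-Reasoning
  n = 2+ k
  Ωₙ = Ω n
  hd lt : Vec (Fin n) n → ℕ
  hd ω = toℕ (Vec.head ω)
  lt ω = toℕ (Vec.last ω)
  pick-endpoints : ∀ ω → ∑[ a < n ] ∑[ b < n ] 𝟙 (hd ω ≡ᵇ a) * (𝟙 (lt ω ≡ᵇ b) * F a b) ≡ F (hd ω) (lt ω)
  pick-endpoints ω = begin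
    ∑[ a < n ] ∑[ b < n ] 𝟙 (hd ω ≡ᵇ a) * (𝟙 (lt ω ≡ᵇ b) * F a b)
      ≡⟨ ∑<-cong n (λ a _ → ∑<-*ˡ n (𝟙 (hd ω ≡ᵇ a)) _) ⟩
    ∑[ a < n ] 𝟙 (hd ω ≡ᵇ a) * (∑[ b < n ] 𝟙 (lt ω ≡ᵇ b) * F a b)
      ≡⟨ ∑<-pick-< _ (Finₚ.toℕ<n (Vec.head ω)) ⟩
    ∑[ b < n ] 𝟙 (lt ω ≡ᵇ b) * F (hd ω) b
      ≡⟨ ∑<-pick-< _ (Finₚ.toℕ<n (Vec.last ω)) ⟩
    F (hd ω) (lt ω) ∎
  swap-c₀ : ∀ x c f → x * c * f ≡ c * (x * f)
  swap-c₀ = solve-∀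

∑<-off-diagonal : ∀ n (F : ℕ → ℕ → ℕ) →
                  ∑[ a < n ] ∑[ b < n ] 𝟙 (not (a ≡ᵇ b)) * F a b
                  ≡ (∑[ a < n ] ∑[ b < a ] F b a) + (∑[ a < n ] ∑[ b < a ] F a b)
∑<-off-diagonal zero    F = refl
∑<-off-diagonal (suc n) F = begin
  ∑[ a < n ] (∑< n (G a) + G a n) + (∑< n (G n) + G n n)
    ≡⟨ cong₂ _+_ (∑<-+ n (λ a → ∑< n (G a)) (λ a → G a n))
                 (cong₂ _+_ (∑<-cong n (λ b b<n → G-off b n (<⇒≢ b<n ∘ sym)))
                            (cong (λ z → 𝟙 (not z) * F n n) (≡⇒≡ᵇ-true {n} refl))) ⟩
  (∑[ a < n ] ∑< n (G a)) + (∑[ a < n ] G a n) + ((∑[ b < n ] F n b) + 0)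
    ≡⟨ cong₂ (λ x y → x + y + ((∑[ b < n ] F n b) + 0))
             (∑<-off-diagonal n F) (∑<-cong n (λ a a<n → G-off n a (<⇒≢ a<n))) ⟩
  T₁ + T₂ + (∑[ a < n ] F a n) + ((∑[ b < n ] F n b) + 0)
    ≡⟨ rearrange T₁ T₂ (∑[ a < n ] F a n) (∑[ b < n ] F n b) ⟩
  (T₁ + ∑[ a < n ] F a n) + (T₂ + ∑[ b < n ] F n b) ∎
  where
  open ≡-Reasoning
  G : ℕ → ℕ → ℕ
  G a b = 𝟙 (not (a ≡ᵇ b)) * F a b
  G-off : ∀ b a → a ≢ b → G a b ≡ F a b
  G-off b a a≢b = trans (cong (λ z → 𝟙 (not z) * F a b) (≢⇒≡ᵇ-false a≢b)) (+-identityʳ (F a b))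
  T₁ = ∑[ a < n ] ∑[ b < a ] F b a
  T₂ = ∑[ a < n ] ∑[ b < a ] F a b
  rearrange : ∀ x y z w → x + y + z + (w + 0) ≡ (x + z) + (y + w)
  rearrange = solve-∀

∑Ω-symmetric : ∀ k (X : Vec (Fin (2+ k)) (2+ k) → ℕ) (F : ℕ → ℕ → ℕ) → (∀ a b → F a b ≡ F b a) →
               (∀ ω → Unique (Vec.toList ω) → X ω ≡ F (toℕ (Vec.head ω)) (toℕ (Vec.last ω))) →
               ∑ˡ (Ω (2+ k)) X ≡ c₀ k * (2 * (∑[ a < 2+ k ] ∑[ b < a ] F b a))
∑Ω-symmetric k X F F-sym X≡F = begin
  ∑ˡ (Ω (2+ k)) X
    ≡⟨ ∑Ω-cong X≡F ⟩
  ∑[ ω ∈ Ω (2+ k) ] F (toℕ (Vec.head ω)) (toℕ (Vec.last ω))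
    ≡⟨ ∑Ω-endpoints k F ⟩
  c₀ k * (∑[ a < 2+ k ] ∑[ b < 2+ k ] 𝟙 (not (a ≡ᵇ b)) * F a b)
    ≡⟨ cong (c₀ k *_) (∑<-off-diagonal (2+ k) F) ⟩
  c₀ k * (tri + ∑[ a < 2+ k ] ∑[ b < a ] F a b)
    ≡⟨ cong (λ t → c₀ k * (tri + t)) (∑<-cong (2+ k) (λ a _ → ∑<-cong a (λ b _ → F-sym a b))) ⟩
  c₀ k * (tri + tri)
    ≡⟨ cong (λ t → c₀ k * (tri + t)) (+-identityʳ tri) ⟨
  c₀ k * (2 * tri)                                                    ∎
  where
  open ≡-Reasoning
  tri = ∑[ a < 2+ k ] ∑[ b < a ] F b a

-- Sums over the triangle b < a < n

∸-suc-involutive : ∀ {n c} → c < n → n ∸ suc (n ∸ suc c) ≡ c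
∸-suc-involutive {suc n} c<1+n = m∸[m∸n]≡n (≤-pred c<1+n)

∸-suc : ∀ {n c} → c < n → n ∸ c ≡ suc (n ∸ suc c)
∸-suc c<n = +-∸-assoc 1 c<n

∑<-C : ∀ n k → ∑[ a < n ] (a C k) ≡ n C suc k
∑<-C zero    k = refl
∑<-C (suc n) k = trans (cong (_+ n C k) (∑<-C n k)) (trans (+-comm (n C suc k) (n C k)) (nCk+nC[k+1]≡[n+1]C[k+1] n k))

∑<-id : ∀ n → ∑[ a < n ] a ≡ n C 2
∑<-id n = trans (∑<-cong n (λ a _ → sym (nC1≡n a))) (∑<-C n 1)

2*[1+m]C2 : ∀ m → 2 * (suc m C 2) ≡ suc m * m
2*[1+m]C2 zero    = refl
2*[1+m]C2 (suc m) = begin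
  2 * (2+ m C 2)                 ≡⟨ cong (2 *_) (nCk+nC[k+1]≡[n+1]C[k+1] (suc m) 1) ⟨
  2 * (suc m C 1 + suc m C 2)    ≡⟨ cong (λ t → 2 * (t + suc m C 2)) (nC1≡n (suc m)) ⟩
  2 * (suc m + suc m C 2)        ≡⟨ *-distribˡ-+ 2 (suc m) _ ⟩
  2 * suc m + 2 * (suc m C 2)    ≡⟨ cong (_+_ (2 * suc m)) (2*[1+m]C2 m) ⟩
  2 * suc m + suc m * m          ≡⟨ step m ⟩
  2+ m * suc m                   ∎
  where
  open ≡-Reasoning
  step : ∀ m → 2 * suc m + suc m * m ≡ 2+ m * suc m
  step = solve-∀

3*[2+m]C3 : ∀ m → 3 * (2+ m C 3) ≡ m * (2+ m C 2)
3*[2+m]C3 zero    = refl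
3*[2+m]C3 (suc m) = begin
  3 * ((3 + m) C 3)                   ≡⟨ cong (3 *_) (nCk+nC[k+1]≡[n+1]C[k+1] (2+ m) 2) ⟨
  3 * (X + 2+ m C 3)                  ≡⟨ *-distribˡ-+ 3 X _ ⟩
  3 * X + 3 * (2+ m C 3)              ≡⟨ cong (_+_ (3 * X)) (3*[2+m]C3 m) ⟩
  3 * X + m * X                       ≡⟨ step₁ m X ⟩
  2 * X + suc m * X                   ≡⟨ cong (_+ suc m * X) (2*[1+m]C2 (suc m)) ⟩
  2+ m * suc m + suc m * X            ≡⟨ step₂ m X ⟩
  suc m * (2+ m + X)                  ≡⟨ cong (λ t → suc m * (t + X)) (nC1≡n (2+ m)) ⟨
  suc m * (2+ m C 1 + X)              ≡⟨ cong (suc m *_) (nCk+nC[k+1]≡[n+1]C[k+1] (2+ m) 1) ⟩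
  suc m * ((3 + m) C 2)               ∎
  where
  open ≡-Reasoning
  X = 2+ m C 2
  step₁ : ∀ m x → 3 * x + m * x ≡ 2 * x + suc m * x
  step₁ = solve-∀
  step₂ : ∀ m x → 2+ m * suc m + suc m * x ≡ suc m * (2+ m + x)
  step₂ = solve-∀

[2+k]C2≢0 : ∀ k → 2+ k C 2 ≢ 0
[2+k]C2≢0 k C≡0 with trans (sym (2*[1+m]C2 (suc k))) (cong (2 *_) C≡0)
... | ()

triangle-count : ∀ n → ∑[ a < n ] ∑[ b < a ] 1 ≡ n C 2
triangle-count n = trans (∑<-cong n (λ a _ → trans (∑<-const a 1) (*-identityʳ a))) (∑<-id n)

triangle-gap : ∀ n → ∑[ a < n ] ∑[ b < a ] (a ∸ suc b) ≡ n C 3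
triangle-gap n = trans (∑<-cong n (λ a _ → gaps a)) (∑<-C n 2)
  where
  gaps : ∀ a → ∑[ b < a ] (a ∸ suc b) ≡ a C 2
  gaps a = trans (∑<-reverse a _) (trans (∑<-cong a (λ b b<a → ∸-suc-involutive b<a)) (∑<-id a))

triangle-below : ∀ n j → ∑[ a < n ] ∑[ b < a ] 𝟙 (b ≡ᵇ j) ≡ n ∸ suc j
triangle-below n j = trans (∑<-cong n (λ a _ → ∑<-count-≡ a j)) (∑<-count-> n j)

triangle-between : ∀ n j → ∑[ a < n ] ∑[ b < a ] 𝟙 (a ∸ suc b ≡ᵇ j) ≡ n ∸ suc j
triangle-between n j = trans (∑<-cong n (λ a _ → reflect a)) (triangle-below n j)
  where
  reflect : ∀ a → ∑[ b < a ] 𝟙 (a ∸ suc b ≡ᵇ j) ≡ ∑[ b < a ] 𝟙 (b ≡ᵇ j)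
  reflect a = trans (∑<-reverse a _) (∑<-cong a (λ b b<a → cong (λ c → 𝟙 (c ≡ᵇ j)) (∸-suc-involutive b<a)))

triangle-above : ∀ n j → ∑[ a < n ] ∑[ b < a ] 𝟙 (n ∸ suc a ≡ᵇ j) ≡ n ∸ suc j
triangle-above n j = begin
  ∑[ a < n ] ∑[ b < a ] 𝟙 (n ∸ suc a ≡ᵇ j)
    ≡⟨ ∑<-cong n (λ a _ → ∑<-const a _) ⟩
  ∑[ a < n ] a * 𝟙 (n ∸ suc a ≡ᵇ j)
    ≡⟨ ∑<-reverse n _ ⟩
  ∑[ c < n ] (n ∸ suc c) * 𝟙 (n ∸ suc (n ∸ suc c) ≡ᵇ j)
    ≡⟨ ∑<-cong n (λ c c<n →
         trans (cong (λ d → (n ∸ suc c) * 𝟙 (d ≡ᵇ j)) (∸-suc-involutive c<n)) (*-comm (n ∸ suc c) _)) ⟩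
  ∑[ c < n ] 𝟙 (c ≡ᵇ j) * (n ∸ suc c)
    ≡⟨ ∑<-pickʳ n j (λ c → n ∸ suc c) ⟩
  𝟙 (j <ᵇ n) * (n ∸ suc j)
    ≡⟨ drop-indicator ⟩
  n ∸ suc j ∎
  where
  open ≡-Reasoning
  drop-indicator : 𝟙 (j <ᵇ n) * (n ∸ suc j) ≡ n ∸ suc j
  drop-indicator with j <? n
  ... | yes j<n rewrite <⇒<ᵇ-true j<n = *-identityˡ _
  ... | no j≮n  rewrite ≮⇒<ᵇ-false j≮n = sym (m≤n⇒m∸n≡0 (m≤n⇒m≤1+n (≮⇒≥ j≮n)))

𝟙-<ᵇ-∸ : ∀ s a m → 𝟙 (s <ᵇ a) * 𝟙 (a ∸ suc s ≡ᵇ m) ≡ 𝟙 (s + suc m ≡ᵇ a)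
𝟙-<ᵇ-∸ s a m with s <? a
... | yes s<a rewrite <⇒<ᵇ-true s<a = trans (*-identityˡ _) (cong 𝟙 (≡ᵇ-cong-⇔ to from))
  where
  to : a ∸ suc s ≡ m → s + suc m ≡ a
  to refl = trans (+-suc s (a ∸ suc s)) (m+[n∸m]≡n s<a)
  from : s + suc m ≡ a → a ∸ suc s ≡ m
  from refl = trans (cong (_∸ suc s) (+-suc s m)) (m+n∸m≡n s m)
... | no s≮a  rewrite ≮⇒<ᵇ-false s≮a =
  sym (cong 𝟙 (≢⇒≡ᵇ-false (λ s+1+m≡a → s≮a (subst (s <_) s+1+m≡a (m<m+n s ℕ.z<s)))))

triangle-joint : ∀ k s m l →
                 ∑[ a < 2+ k ] ∑[ b < a ] 𝟙 ((b ≡ᵇ s) ∧ ((a ∸ suc b ≡ᵇ m) ∧ (2+ k ∸ suc a ≡ᵇ l)))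
                 ≡ 𝟙 (s + m + l ≡ᵇ k)
triangle-joint k s m l = begin
  ∑[ a < n ] ∑[ b < a ] 𝟙 ((b ≡ᵇ s) ∧ ((a ∸ suc b ≡ᵇ m) ∧ last-gap a))
    ≡⟨ ∑<-cong n (λ a _ → ∑<-cong a (λ b _ → 𝟙-∧ (b ≡ᵇ s) _)) ⟩
  ∑[ a < n ] ∑[ b < a ] 𝟙 (b ≡ᵇ s) * 𝟙 ((a ∸ suc b ≡ᵇ m) ∧ last-gap a)
    ≡⟨ ∑<-cong n (λ a _ → ∑<-pickʳ a s (λ b → 𝟙 ((a ∸ suc b ≡ᵇ m) ∧ last-gap a))) ⟩
  ∑[ a < n ] 𝟙 (s <ᵇ a) * 𝟙 ((a ∸ suc s ≡ᵇ m) ∧ last-gap a)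
    ≡⟨ ∑<-cong n (λ a _ → first-gaps a) ⟩
  ∑[ a < n ] 𝟙 (s + suc m ≡ᵇ a) * 𝟙 (last-gap a)
    ≡⟨ ∑<-pick n (s + suc m) (𝟙 ∘ last-gap) ⟩
  𝟙 (s + suc m <ᵇ n) * 𝟙 (last-gap (s + suc m))
    ≡⟨ 𝟙-<ᵇ-∸ (s + suc m) n l ⟩
  𝟙 (s + suc m + suc l ≡ᵇ n)
    ≡⟨ cong 𝟙 (≡ᵇ-cong-⇔ (suc-injective ∘ suc-injective ∘ trans (sym (shuffle s m l)))
                         (trans (shuffle s m l) ∘ cong 2+)) ⟩
  𝟙 (s + m + l ≡ᵇ k) ∎
  where
  open ≡-Reasoning
  n = 2+ k
  last-gap : ℕ → Bool
  last-gap a = n ∸ suc a ≡ᵇ l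
  first-gaps : ∀ a → 𝟙 (s <ᵇ a) * 𝟙 ((a ∸ suc s ≡ᵇ m) ∧ last-gap a) ≡ 𝟙 (s + suc m ≡ᵇ a) * 𝟙 (last-gap a)
  first-gaps a = begin
    𝟙 (s <ᵇ a) * 𝟙 ((a ∸ suc s ≡ᵇ m) ∧ last-gap a)
      ≡⟨ cong (𝟙 (s <ᵇ a) *_) (𝟙-∧ (a ∸ suc s ≡ᵇ m) _) ⟩
    𝟙 (s <ᵇ a) * (𝟙 (a ∸ suc s ≡ᵇ m) * 𝟙 (last-gap a))
      ≡⟨ *-assoc (𝟙 (s <ᵇ a)) _ _ ⟨
    𝟙 (s <ᵇ a) * 𝟙 (a ∸ suc s ≡ᵇ m) * 𝟙 (last-gap a)
      ≡⟨ cong (_* 𝟙 (last-gap a)) (𝟙-<ᵇ-∸ s a m) ⟩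
    𝟙 (s + suc m ≡ᵇ a) * 𝟙 (last-gap a) ∎
  shuffle : ∀ s m l → s + suc m + suc l ≡ 2+ (s + m + l)
  shuffle = solve-∀

-- With c = n − 1 − a, the sum of |L − S| over b < a < n is the sum of |c − b| over b + c ≤ n − 2;
-- from n to n + 1 it gains the antidiagonal b + c = n − 1.
antidiagonalSpread triangleSpread : ℕ → ℕ
antidiagonalSpread n = ∑[ c < n ] ∣ c - (n ∸ suc c) ∣
triangleSpread     n = ∑[ c < n ] ∑[ b < n ∸ suc c ] ∣ c - b ∣

triangle-spread : ∀ n → ∑[ a < n ] ∑[ b < a ] ∣ n ∸ suc a - b ∣ ≡ triangleSpread n
triangle-spread n = trans (∑<-reverse n _)
  (∑<-cong n (λ c c<n → ∑<-cong (n ∸ suc c) (λ b _ → cong (∣_- b ∣) (∸-suc-involutive c<n))))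

triangleSpread-suc : ∀ n → triangleSpread (suc n) ≡ triangleSpread n + antidiagonalSpread n
triangleSpread-suc n = begin
  (∑[ c < n ] ∑[ b < n ∸ c ] ∣ c - b ∣) + ∑[ b < n ∸ n ] ∣ n - b ∣
    ≡⟨ cong₂ _+_ (∑<-cong n (λ c c<n → cong (λ m → ∑[ b < m ] ∣ c - b ∣) (∸-suc c<n)))
                 (cong (λ m → ∑[ b < m ] ∣ n - b ∣) (n∸n≡0 n)) ⟩
  (∑[ c < n ] ((∑[ b < n ∸ suc c ] ∣ c - b ∣) + ∣ c - (n ∸ suc c) ∣)) + 0
    ≡⟨ +-identityʳ _ ⟩
  ∑[ c < n ] ((∑[ b < n ∸ suc c ] ∣ c - b ∣) + ∣ c - (n ∸ suc c) ∣)
    ≡⟨ ∑<-+ n _ _ ⟩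
  triangleSpread n + antidiagonalSpread n ∎
  where open ≡-Reasoning

antidiagonalSpread-2+ : ∀ n → antidiagonalSpread (2+ n) ≡ antidiagonalSpread n + 2 * suc n
antidiagonalSpread-2+ n = begin
  ∑[ c < 2+ n ] ∣ c - (suc n ∸ c) ∣
    ≡⟨ ∑<-shift (suc n) _ ⟩
  suc n + ((∑[ c < n ] ∣ suc c - (n ∸ c) ∣) + ∣ suc n - (n ∸ n) ∣)
    ≡⟨ cong (λ t → suc n + (t + ∣ suc n - (n ∸ n) ∣)) (∑<-cong n (λ c c<n → cong (∣ suc c -_∣) (∸-suc c<n))) ⟩
  suc n + (antidiagonalSpread n + ∣ suc n - (n ∸ n) ∣)
    ≡⟨ cong (λ m → suc n + (antidiagonalSpread n + ∣ suc n - m ∣)) (n∸n≡0 n) ⟩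
  suc n + (antidiagonalSpread n + suc n)
    ≡⟨ shuffle (suc n) (antidiagonalSpread n) ⟩
  antidiagonalSpread n + 2 * suc n ∎
  where
  open ≡-Reasoning
  shuffle : ∀ a d → a + (d + a) ≡ d + 2 * a
  shuffle = solve-∀

antidiagonalSpread-even : ∀ j → antidiagonalSpread (2 * j) ≡ 2 * j * j
antidiagonalSpread-even zero    = refl
antidiagonalSpread-even (suc j) = begin
  antidiagonalSpread (2 * suc j)            ≡⟨ cong antidiagonalSpread (*-suc 2 j) ⟩
  antidiagonalSpread (2+ (2 * j))           ≡⟨ antidiagonalSpread-2+ (2 * j) ⟩
  antidiagonalSpread (2 * j) + 2 * suc (2 * j) ≡⟨ cong (_+ 2 * suc (2 * j)) (antidiagonalSpread-even j) ⟩
  2 * j * j + 2 * suc (2 * j)               ≡⟨ step j ⟩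
  2 * suc j * suc j                         ∎
  where
  open ≡-Reasoning
  step : ∀ j → 2 * j * j + 2 * suc (2 * j) ≡ 2 * suc j * suc j
  step = solve-∀

antidiagonalSpread-odd : ∀ j → antidiagonalSpread (suc (2 * j)) ≡ 2 * j * suc j
antidiagonalSpread-odd zero    = refl
antidiagonalSpread-odd (suc j) = begin
  antidiagonalSpread (suc (2 * suc j))      ≡⟨ cong (antidiagonalSpread ∘ suc) (*-suc 2 j) ⟩
  antidiagonalSpread (2+ (suc (2 * j)))     ≡⟨ antidiagonalSpread-2+ (suc (2 * j)) ⟩
  antidiagonalSpread (suc (2 * j)) + 2 * 2+ (2 * j) ≡⟨ cong (_+ 2 * 2+ (2 * j)) (antidiagonalSpread-odd j) ⟩
  2 * j * suc j + 2 * 2+ (2 * j)            ≡⟨ step j ⟩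
  2 * suc j * 2+ j                          ∎
  where
  open ≡-Reasoning
  step : ∀ j → 2 * j * suc j + 2 * 2+ (2 * j) ≡ 2 * suc j * 2+ j
  step = solve-∀

triangleSpread-even : ∀ j → 3 * triangleSpread (2+ (2 * j)) ≡ j * suc j * (4 * j + 5)
triangleSpread-odd  : ∀ j → 3 * triangleSpread (3 + 2 * j) ≡ suc j * 2+ j * (4 * j + 3)

triangleSpread-even zero    = refl
triangleSpread-even (suc j) = begin
  3 * triangleSpread (2+ (2 * suc j))
    ≡⟨ cong (λ m → 3 * triangleSpread (2+ m)) (*-suc 2 j) ⟩
  3 * triangleSpread (3 + suc (2 * j))
    ≡⟨ cong (3 *_) (triangleSpread-suc (3 + 2 * j)) ⟩
  3 * (triangleSpread (3 + 2 * j) + antidiagonalSpread (3 + 2 * j))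
    ≡⟨ cong (λ m → 3 * (triangleSpread (3 + 2 * j) + antidiagonalSpread (suc m))) (*-suc 2 j) ⟨
  3 * (triangleSpread (3 + 2 * j) + antidiagonalSpread (suc (2 * suc j)))
    ≡⟨ cong (λ m → 3 * (triangleSpread (3 + 2 * j) + m)) (antidiagonalSpread-odd (suc j)) ⟩
  3 * (triangleSpread (3 + 2 * j) + 2 * suc j * 2+ j)
    ≡⟨ *-distribˡ-+ 3 (triangleSpread (3 + 2 * j)) _ ⟩
  3 * triangleSpread (3 + 2 * j) + 3 * (2 * suc j * 2+ j)
    ≡⟨ cong (_+ 3 * (2 * suc j * 2+ j)) (triangleSpread-odd j) ⟩
  suc j * 2+ j * (4 * j + 3) + 3 * (2 * suc j * 2+ j)
    ≡⟨ step j ⟩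
  suc j * suc (suc j) * (4 * suc j + 5)                            ∎
  where
  open ≡-Reasoning
  step : ∀ j → suc j * 2+ j * (4 * j + 3) + 3 * (2 * suc j * 2+ j) ≡ suc j * suc (suc j) * (4 * suc j + 5)
  step = solve-∀

triangleSpread-odd j = begin
  3 * triangleSpread (3 + 2 * j)
    ≡⟨ cong (3 *_) (triangleSpread-suc (2+ (2 * j))) ⟩
  3 * (triangleSpread (2+ (2 * j)) + antidiagonalSpread (2+ (2 * j)))
    ≡⟨ cong (λ m → 3 * (triangleSpread (2+ (2 * j)) + antidiagonalSpread m)) (sym (*-suc 2 j)) ⟩
  3 * (triangleSpread (2+ (2 * j)) + antidiagonalSpread (2 * suc j))
    ≡⟨ cong (λ m → 3 * (triangleSpread (2+ (2 * j)) + m)) (antidiagonalSpread-even (suc j)) ⟩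
  3 * (triangleSpread (2+ (2 * j)) + 2 * suc j * suc j)
    ≡⟨ *-distribˡ-+ 3 (triangleSpread (2+ (2 * j))) _ ⟩
  3 * triangleSpread (2+ (2 * j)) + 3 * (2 * suc j * suc j)
    ≡⟨ cong (_+ 3 * (2 * suc j * suc j)) (triangleSpread-even j) ⟩
  j * suc j * (4 * j + 5) + 3 * (2 * suc j * suc j)
    ≡⟨ step j ⟩
  suc j * 2+ j * (4 * j + 3)                                       ∎
  where
  open ≡-Reasoning
  step : ∀ j → j * suc j * (4 * j + 5) + 3 * (2 * suc j * suc j) ≡ suc j * 2+ j * (4 * j + 3)
  step = solve-∀

-- Stars and bars

∑<-solutions-of-+ : ∀ N t → ∑[ l < suc N ] 𝟙 (t + l ≡ᵇ N) ≡ 𝟙 (t <ᵇ suc N)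
∑<-solutions-of-+ N t with t ≤? N
... | yes t≤N rewrite <⇒<ᵇ-true (s≤s t≤N) = begin
  ∑[ l < suc N ] 𝟙 (t + l ≡ᵇ N)
    ≡⟨ ∑<-cong (suc N) (λ l _ → trans (cong 𝟙 (≡ᵇ-cong-⇔ to from)) (sym (*-identityʳ _))) ⟩
  ∑[ l < suc N ] 𝟙 (N ∸ t ≡ᵇ l) * 1
    ≡⟨ ∑<-pick-< (λ _ → 1) (s≤s (m∸n≤m N t)) ⟩
  1                                      ∎
  where
  open ≡-Reasoning
  to : ∀ {l} → t + l ≡ N → N ∸ t ≡ l
  to {l} refl = m+n∸m≡n t l
  from : ∀ {l} → N ∸ t ≡ l → t + l ≡ N
  from refl = m+[n∸m]≡n t≤N
... | no t≰N  rewrite ≮⇒<ᵇ-false (t≰N ∘ ≤-pred) =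
  ∑<-zero (suc N) (λ l _ → cong 𝟙 (≢⇒≡ᵇ-false (λ t+l≡N → t≰N (subst (t ≤_) t+l≡N (m≤m+n t l)))))

∑<-count-+< : ∀ S s → ∑[ m < S ] 𝟙 (s + m <ᵇ S) ≡ S ∸ s
∑<-count-+< S s = begin
  ∑[ m < S ] 𝟙 (s + m <ᵇ S)
    ≡⟨ ∑<-cong S (λ m _ → cong 𝟙 (does-⇔ (mk⇔ to from) (s + m <? S) (m <? S ∸ s))) ⟩
  ∑[ m < S ] 𝟙 (m <ᵇ S ∸ s)
    ≡⟨ ∑<-count-< S (S ∸ s) ⟩
  S ⊓ (S ∸ s)
    ≡⟨ m≥n⇒m⊓n≡n (m∸n≤m S s) ⟩
  S ∸ s ∎
  where
  open ≡-Reasoning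
  to : ∀ {m} → s + m < S → m < S ∸ s
  to {m} s+m<S = m+n≤o⇒m≤o∸n (suc m) (subst (_≤ S) (cong suc (+-comm s m)) s+m<S)
  from : ∀ {m} → m < S ∸ s → s + m < S
  from {m} m<S∸s = subst (_≤ S) (cong suc (+-comm m s))
    (m≤o∸n⇒m+n≤o (suc m) (<⇒≤ (m∸n≢0⇒n<m (λ S∸s≡0 → <⇒≢ (≤-trans ℕ.z<s m<S∸s) (sym S∸s≡0)))) m<S∸s)

length-Ω′ : ∀ N → length (Ω′ N) ≡ 2+ N C 2
length-Ω′ N = begin
  length (Ω′ N)
    ≡⟨ length-filterᵇ sums-to-N triples ⟩
  ∑[ t ∈ triples ] 𝟙 (sums-to-N t)
    ≡⟨ ∑ˡ-concatMap (λ s → concatMap (λ m → map (λ l → s , m , l) U) U) U (𝟙 ∘ sums-to-N) ⟩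
  ∑[ s ∈ U ] ∑ˡ (concatMap (λ m → map (λ l → s , m , l) U) U) (𝟙 ∘ sums-to-N)
    ≡⟨ ∑ˡ-cong U (λ s → trans (∑ˡ-concatMap (λ m → map (λ l → s , m , l) U) U _)
                              (∑ˡ-cong U (λ m → ∑ˡ-map (λ l → s , m , l) U (𝟙 ∘ sums-to-N)))) ⟩
  ∑[ s ∈ U ] ∑[ m ∈ U ] ∑[ l ∈ U ] 𝟙 (s + m + l ≡ᵇ N)
    ≡⟨ ∑ˡ-applyUpTo id (suc N) _ ⟩
  ∑[ s < suc N ] ∑[ m ∈ U ] ∑[ l ∈ U ] 𝟙 (s + m + l ≡ᵇ N)
    ≡⟨ ∑<-cong (suc N) (λ s _ →
         trans (∑ˡ-applyUpTo id (suc N) _) (∑<-cong (suc N) (λ m _ → ∑ˡ-applyUpTo id (suc N) _))) ⟩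
  ∑[ s < suc N ] ∑[ m < suc N ] ∑[ l < suc N ] 𝟙 (s + m + l ≡ᵇ N)
    ≡⟨ ∑<-cong (suc N) (λ s _ → ∑<-cong (suc N) (λ m _ → ∑<-solutions-of-+ N (s + m))) ⟩
  ∑[ s < suc N ] ∑[ m < suc N ] 𝟙 (s + m <ᵇ suc N)
    ≡⟨ ∑<-cong (suc N) (λ s _ → ∑<-count-+< (suc N) s) ⟩
  ∑[ s < suc N ] (suc N ∸ s)
    ≡⟨ ∑<-reverse (suc N) _ ⟩
  ∑[ c < suc N ] (suc N ∸ (N ∸ c))
    ≡⟨ ∑<-cong (suc N) (λ c c<1+N → trans (+-∸-assoc 1 (m∸n≤m N c)) (cong suc (m∸[m∸n]≡n (≤-pred c<1+N)))) ⟩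
  ∑[ c < suc N ] suc c
    ≡⟨ ∑<-shift (suc N) id ⟨
  ∑[ a < 2+ N ] a
    ≡⟨ ∑<-id (2+ N) ⟩
  2+ N C 2 ∎
  where
  open ≡-Reasoning
  U = upTo (suc N)
  sums-to-N : ℕ × ℕ × ℕ → Bool
  sums-to-N (s , m , l) = s + m + l ≡ᵇ N
  triples = concatMap (λ s → concatMap (λ m → map (λ l → s , m , l) U) U) U

-- Averages over the orderings

/-cross : ∀ a b c d .{{_ : NonZero b}} .{{_ : NonZero d}} → a * d ≡ c * b → + a / b ≡ + c / d
/-cross a (suc b) c (suc d) eq =
  ℚₚ.fromℚᵘ-cong {ℚᵘ.mkℚᵘ (+ a) b} {ℚᵘ.mkℚᵘ (+ c) d}
    (ℚᵘ.*≡* (trans (sym (ℤₚ.pos-* a (suc d))) (trans (cong +_ eq) (ℤₚ.pos-* c (suc b)))))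

/-+ : ∀ a b c d .{{_ : NonZero b}} .{{_ : NonZero d}} →
      + a / b ℚ.+ + c / d ≡ ℚ._/_ (+ (a * d + c * b)) (b * d) {{m*n≢0 b d}}
/-+ a (suc b) c (suc d) = ℚₚ.toℚᵘ-injective (begin
  ℚ.toℚᵘ (+ a / suc b ℚ.+ + c / suc d)
    ≈⟨ ℚₚ.toℚᵘ-homo-+ (+ a / suc b) (+ c / suc d) ⟩
  ℚ.toℚᵘ (+ a / suc b) ℚᵘ.+ ℚ.toℚᵘ (+ c / suc d)
    ≈⟨ ℚᵘₚ.+-cong (ℚₚ.toℚᵘ-fromℚᵘ (ℚᵘ.mkℚᵘ (+ a) b)) (ℚₚ.toℚᵘ-fromℚᵘ (ℚᵘ.mkℚᵘ (+ c) d)) ⟩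
  ℚᵘ.mkℚᵘ (+ a) b ℚᵘ.+ ℚᵘ.mkℚᵘ (+ c) d
    ≡⟨ cong (λ z → ℚᵘ.mkℚᵘ z (d + b * suc d)) numerator ⟩
  ℚᵘ.mkℚᵘ (+ (a * suc d + c * suc b)) (d + b * suc d)
    ≈⟨ ℚₚ.toℚᵘ-fromℚᵘ (ℚᵘ.mkℚᵘ (+ (a * suc d + c * suc b)) (d + b * suc d)) ⟨
  ℚ.toℚᵘ (+ (a * suc d + c * suc b) / (suc b * suc d)) ∎)
  where
  open ℚᵘₚ.≃-Reasoning
  numerator : + a ℤ.* + suc d ℤ.+ + c ℤ.* + suc b ≡ + (a * suc d + c * suc b)
  numerator =
    sym (trans (ℤₚ.pos-+ (a * suc d) (c * suc b)) (cong₂ ℤ._+_ (ℤₚ.pos-* a (suc d)) (ℤₚ.pos-* c (suc b))))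

/-* : ∀ a b c d .{{_ : NonZero b}} .{{_ : NonZero d}} →
      (+ a / b) ℚ.* (+ c / d) ≡ ℚ._/_ (+ (a * c)) (b * d) {{m*n≢0 b d}}
/-* a (suc b) c (suc d) = ℚₚ.toℚᵘ-injective (begin
  ℚ.toℚᵘ ((+ a / suc b) ℚ.* (+ c / suc d))
    ≈⟨ ℚₚ.toℚᵘ-homo-* (+ a / suc b) (+ c / suc d) ⟩
  ℚ.toℚᵘ (+ a / suc b) ℚᵘ.* ℚ.toℚᵘ (+ c / suc d)
    ≈⟨ ℚᵘₚ.*-cong (ℚₚ.toℚᵘ-fromℚᵘ (ℚᵘ.mkℚᵘ (+ a) b)) (ℚₚ.toℚᵘ-fromℚᵘ (ℚᵘ.mkℚᵘ (+ c) d)) ⟩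
  ℚᵘ.mkℚᵘ (+ a ℤ.* + c) (d + b * suc d)
    ≡⟨ cong (λ z → ℚᵘ.mkℚᵘ z (d + b * suc d)) (ℤₚ.pos-* a c) ⟨
  ℚᵘ.mkℚᵘ (+ (a * c)) (d + b * suc d)
    ≈⟨ ℚₚ.toℚᵘ-fromℚᵘ (ℚᵘ.mkℚᵘ (+ (a * c)) (d + b * suc d)) ⟨
  ℚ.toℚᵘ (+ (a * c) / (suc b * suc d)) ∎)
  where open ℚᵘₚ.≃-Reasoning

x≡z+y⇒x-y≡z : ∀ x y z → x ≡ z ℚ.+ y → x ℚ.- y ≡ z
x≡z+y⇒x-y≡z x y z refl =
  trans (ℚₚ.+-assoc z y (ℚ.- y)) (trans (cong (z ℚ.+_) (ℚₚ.+-inverseʳ y)) (ℚₚ.+-identityʳ z))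

÷ℕ-suc : ∀ x d → (+ x / 1) ÷ℕ suc d ≡ + x / suc d
÷ℕ-suc x d = trans (/-* x 1 1 (suc d)) (/-cross (x * 1) (1 * suc d) x (suc d) (*-assoc x 1 (suc d)))

÷ℕ-nonZero : ∀ x d .{{_ : NonZero d}} → (+ x / 1) ÷ℕ d ≡ + x / d
÷ℕ-nonZero x (suc d) = ÷ℕ-suc x d

÷ℕ-cancel : ∀ c x d → 0 < c → (+ (c * x) / 1) ÷ℕ (c * d) ≡ (+ x / 1) ÷ℕ d
÷ℕ-cancel c x zero    _ rewrite *-zeroʳ c = refl
÷ℕ-cancel (suc c) x (suc d) _ = begin
  (+ (suc c * x) / 1) ÷ℕ (suc c * suc d)
    ≡⟨ ÷ℕ-suc (suc c * x) (d + c * suc d) ⟩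
  + (suc c * x) / (suc c * suc d)
    ≡⟨ /-cross (suc c * x) (suc c * suc d) x (suc d) (reassociate (suc c) x (suc d)) ⟩
  + x / suc d
    ≡⟨ ÷ℕ-suc x d ⟨
  (+ x / 1) ÷ℕ suc d                       ∎
  where
  open ≡-Reasoning
  reassociate : ∀ c x d → c * x * d ≡ x * (c * d)
  reassociate = solve-∀

0÷ℕ : ∀ d → (+ 0 / 1) ÷ℕ d ≡ 0ℚ
0÷ℕ zero    = refl
0÷ℕ (suc d) = ℚₚ.*-zeroˡ (+ 1 / suc d)

foldr-+-as-∑ˡ : ∀ xs (f : A → ℕ) → foldr (λ x acc → (+ f x / 1) ℚ.+ acc) 0ℚ xs ≡ + ∑ˡ xs f / 1
foldr-+-as-∑ˡ []       f = refl
foldr-+-as-∑ˡ (x ∷ xs) f = begin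
  + f x / 1 ℚ.+ foldr (λ x acc → (+ f x / 1) ℚ.+ acc) 0ℚ xs
    ≡⟨ cong (+ f x / 1 ℚ.+_) (foldr-+-as-∑ˡ xs f) ⟩
  + f x / 1 ℚ.+ + ∑ˡ xs f / 1
    ≡⟨ /-+ (f x) 1 (∑ˡ xs f) 1 ⟩
  + (f x * 1 + ∑ˡ xs f * 1) / (1 * 1)
    ≡⟨ /-cross (f x * 1 + ∑ˡ xs f * 1) (1 * 1) (f x + ∑ˡ xs f) 1 (drop-ones (f x) (∑ˡ xs f)) ⟩
  + (f x + ∑ˡ xs f) / 1                                     ∎
  where
  open ≡-Reasoning
  drop-ones : ∀ a b → (a * 1 + b * 1) * 1 ≡ (a + b) * (1 * 1)
  drop-ones = solve-∀

length-Ω : ∀ k → length (Ω (2+ k)) ≡ c₀ k * 2 * (2+ k C 2)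
length-Ω k = begin
  length (Ω (2+ k))
    ≡⟨ length≡∑ˡ1 (Ω (2+ k)) ⟩
  ∑[ ω ∈ Ω (2+ k) ] 1
    ≡⟨ ∑Ω-symmetric k (λ _ → 1) (λ _ _ → 1) (λ _ _ → refl) (λ _ _ → refl) ⟩
  c₀ k * (2 * (∑[ a < 2+ k ] ∑[ b < a ] 1))
    ≡⟨ *-assoc (c₀ k) 2 _ ⟨
  c₀ k * 2 * (∑[ a < 2+ k ] ∑[ b < a ] 1)
    ≡⟨ cong (c₀ k * 2 *_) (triangle-count (2+ k)) ⟩
  c₀ k * 2 * (2+ k C 2)                                   ∎
  where open ≡-Reasoning

mean-SML : ∀ k (G : ℕ × ℕ × ℕ → ℕ) →
           (+ (∑[ ω ∈ Ω (2+ k) ] G (SML ω)) / 1) ÷ℕ length (Ω (2+ k))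
           ≡ (+ (∑[ a < 2+ k ] ∑[ b < a ] G (b , a ∸ suc b , 2+ k ∸ suc a)) / 1) ÷ℕ (2+ k C 2)
mean-SML k G = begin
  (+ (∑[ ω ∈ Ω n ] G (SML ω)) / 1) ÷ℕ length (Ω n)
    ≡⟨ cong₂ (λ t d → (+ t / 1) ÷ℕ d)
             (∑Ω-symmetric k (G ∘ SML) F F-comm (λ ω uω → cong G (SML-endpoints ω uω))) (length-Ω k) ⟩
  (+ (c₀ k * (2 * tri F)) / 1) ÷ℕ (c₀ k * 2 * (n C 2))
    ≡⟨ cong (λ t → (+ t / 1) ÷ℕ (c₀ k * 2 * (n C 2))) (*-assoc (c₀ k) 2 (tri F)) ⟨
  (+ (c₀ k * 2 * tri F) / 1) ÷ℕ (c₀ k * 2 * (n C 2))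
    ≡⟨ ÷ℕ-cancel (c₀ k * 2) (tri F) (n C 2) (*-monoˡ-< 2 (c₀-positive k)) ⟩
  (+ tri F / 1) ÷ℕ (n C 2)
    ≡⟨ cong (λ t → (+ t / 1) ÷ℕ (n C 2))
            (∑<-cong n (λ a _ → ∑<-cong a (λ b b<a → cong G (endpointStats-ordered n b<a)))) ⟩
  (+ (∑[ a < n ] ∑[ b < a ] G (b , a ∸ suc b , n ∸ suc a)) / 1) ÷ℕ (n C 2) ∎
  where
  open ≡-Reasoning
  n = 2+ k
  F : ℕ → ℕ → ℕ
  F a b = G (endpointStats n a b)
  F-comm : ∀ a b → F a b ≡ F b a
  F-comm a b = cong G (endpointStats-comm n a b)
  tri : (ℕ → ℕ → ℕ) → ℕ
  tri H = ∑[ a < n ] ∑[ b < a ] H b a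

Pr-SML : ∀ k (P : ℕ × ℕ × ℕ → Bool) →
         Pr (2+ k) (P ∘ SML) ≡ (+ (∑[ a < 2+ k ] ∑[ b < a ] 𝟙 (P (b , a ∸ suc b , 2+ k ∸ suc a))) / 1) ÷ℕ (2+ k C 2)
Pr-SML k P =
  trans (cong (λ t → (+ t / 1) ÷ℕ length (Ω (2+ k))) (length-filterᵇ (P ∘ SML) (Ω (2+ k)))) (mean-SML k (𝟙 ∘ P))

Ex-SML : ∀ k (G : ℕ × ℕ × ℕ → ℕ) →
         Ex (2+ k) (G ∘ SML) ≡ (+ (∑[ a < 2+ k ] ∑[ b < a ] G (b , a ∸ suc b , 2+ k ∸ suc a)) / 1) ÷ℕ (2+ k C 2)
Ex-SML k G = trans (cong (_÷ℕ length (Ω (2+ k))) (foldr-+-as-∑ˡ (Ω (2+ k)) (G ∘ SML))) (mean-SML k G)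

-- The distribution of (S, M, L)

Pr-joint : ∀ k s m l →
           Pr (2+ k) (λ ω → (S ω ≡ᵇ s) ∧ (M ω ≡ᵇ m) ∧ (L ω ≡ᵇ l)) ≡ (+ 𝟙 (s + m + l ≡ᵇ k) / 1) ÷ℕ (2+ k C 2)
Pr-joint k s m l = trans (Pr-SML k (λ t → (proj₁ t ≡ᵇ s) ∧ (proj₁ (proj₂ t) ≡ᵇ m) ∧ (proj₂ (proj₂ t) ≡ᵇ l)))
                         (cong (λ t → (+ t / 1) ÷ℕ (2+ k C 2)) (triangle-joint k s m l))

Pr-joint-on-Ω′ : ∀ k s m l → s + m + l ≡ k →
                 Pr (2+ k) (λ ω → (S ω ≡ᵇ s) ∧ (M ω ≡ᵇ m) ∧ (L ω ≡ᵇ l)) ≡ 1ℚ ÷ℕ length (Ω′ k)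
Pr-joint-on-Ω′ k s m l sum≡k = begin
  Pr (2+ k) (λ ω → (S ω ≡ᵇ s) ∧ (M ω ≡ᵇ m) ∧ (L ω ≡ᵇ l))
    ≡⟨ Pr-joint k s m l ⟩
  (+ 𝟙 (s + m + l ≡ᵇ k) / 1) ÷ℕ (2+ k C 2)
    ≡⟨ cong (λ b → (+ 𝟙 b / 1) ÷ℕ (2+ k C 2)) (≡⇒≡ᵇ-true sum≡k) ⟩
  1ℚ ÷ℕ (2+ k C 2)
    ≡⟨ cong (1ℚ ÷ℕ_) (length-Ω′ k) ⟨
  1ℚ ÷ℕ length (Ω′ k) ∎
  where open ≡-Reasoning

Pr-joint-off-Ω′ : ∀ k s m l → s + m + l ≢ k →
                  Pr (2+ k) (λ ω → (S ω ≡ᵇ s) ∧ (M ω ≡ᵇ m) ∧ (L ω ≡ᵇ l)) ≡ 0ℚ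
Pr-joint-off-Ω′ k s m l sum≢k =
  trans (Pr-joint k s m l)
        (trans (cong (λ b → (+ 𝟙 b / 1) ÷ℕ (2+ k C 2)) (≢⇒≡ᵇ-false sum≢k)) (0÷ℕ (2+ k C 2)))

Pr[S≡j] : ∀ k j → Pr (2+ k) (λ ω → S ω ≡ᵇ j) ≡ (+ (2+ k ∸ suc j) / 1) ÷ℕ (2+ k C 2)
Pr[S≡j] k j = trans (Pr-SML k (λ t → proj₁ t ≡ᵇ j))
                    (cong (λ t → (+ t / 1) ÷ℕ (2+ k C 2)) (triangle-below (2+ k) j))

Pr[M≡j] : ∀ k j → Pr (2+ k) (λ ω → M ω ≡ᵇ j) ≡ (+ (2+ k ∸ suc j) / 1) ÷ℕ (2+ k C 2)
Pr[M≡j] k j = trans (Pr-SML k (λ t → proj₁ (proj₂ t) ≡ᵇ j))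
                    (cong (λ t → (+ t / 1) ÷ℕ (2+ k C 2)) (triangle-between (2+ k) j))

Pr[L≡j] : ∀ k j → Pr (2+ k) (λ ω → L ω ≡ᵇ j) ≡ (+ (2+ k ∸ suc j) / 1) ÷ℕ (2+ k C 2)
Pr[L≡j] k j = trans (Pr-SML k (λ t → proj₂ (proj₂ t) ≡ᵇ j))
                    (cong (λ t → (+ t / 1) ÷ℕ (2+ k C 2)) (triangle-above (2+ k) j))

-- The formula holds for every j: when j > n − 2 both sides vanish.
Pr[M≡j]-formula : ∀ k j → Pr (2+ k) (λ ω → M ω ≡ᵇ j) ≡ (+ (2+ k ∸ j ∸ 1) / 1) ÷ℕ (2+ k C 2)
Pr[M≡j]-formula k j = trans (Pr[M≡j] k j)
  (cong (λ t → (+ t / 1) ÷ℕ (2+ k C 2)) (sym (trans (∸-+-assoc (2+ k) j 1) (cong (2+ k ∸_) (+-comm j 1)))))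

E[M] : ∀ k → Ex (2+ k) M ≡ + k / 3
E[M] k = begin
  Ex (2+ k) M
    ≡⟨ Ex-SML k (proj₁ ∘ proj₂) ⟩
  (+ (∑[ a < 2+ k ] ∑[ b < a ] (a ∸ suc b)) / 1) ÷ℕ (2+ k C 2)
    ≡⟨ cong (λ t → (+ t / 1) ÷ℕ (2+ k C 2)) (triangle-gap (2+ k)) ⟩
  (+ (2+ k C 3) / 1) ÷ℕ (2+ k C 2)
    ≡⟨ ÷ℕ-nonZero (2+ k C 3) (2+ k C 2) {{P≢0}} ⟩
  ℚ._/_ (+ (2+ k C 3)) (2+ k C 2) {{P≢0}}
    ≡⟨ /-cross (2+ k C 3) (2+ k C 2) k 3 {{P≢0}} (trans (*-comm (2+ k C 3) 3) (3*[2+m]C3 k)) ⟩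
  + k / 3 ∎
  where
  open ≡-Reasoning
  P≢0 : NonZero (2+ k C 2)
  P≢0 = ℕ.≢-nonZero ([2+k]C2≢0 k)

-- The generating function of E|L − S|

artanh-even : ∀ j → artanh (2 * j) ≡ 0ℚ
artanh-even j rewrite *-comm 2 j | m*n%n≡0 j 2 ⦃ ℕ.nonZero ⦄ = refl

artanh-odd : ∀ j → artanh (suc (2 * j)) ≡ + 1 / suc (2 * j)
artanh-odd j rewrite *-comm 2 j | [m+kn]%n≡m%n 1 j 2 ⦃ ℕ.nonZero ⦄ = ℚₚ.*-identityˡ _

rhsGF-2+ : ∀ k → rhsGF (2+ k) ≡ (+ 1 / 3) ℚ.* (+ (3 + k) / 1) ℚ.- (+ 1 / 2) ℚ.* 1ℚ
                                ℚ.- (+ 1 / 2) ℚ.* (artanh (2+ k) ℚ.+ artanh (suc k))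
rhsGF-2+ k = begin
  X ℚ.+ 0ℚ ℚ.+ (+ 1 / 3) ℚ.* 0ℚ
    ≡⟨ cong₂ ℚ._+_ (ℚₚ.+-identityʳ X) (ℚₚ.*-zeroʳ (+ 1 / 3)) ⟩
  X ℚ.+ 0ℚ
    ≡⟨ ℚₚ.+-identityʳ X ⟩
  X
    ≡⟨ cong₂ (λ g c → (+ 1 / 3) ℚ.* g ℚ.- (+ 1 / 2) ℚ.* 1ℚ ℚ.- (+ 1 / 2) ℚ.* c) geom⊛geom [1+z]⊛artanh ⟩
  (+ 1 / 3) ℚ.* (+ (3 + k) / 1) ℚ.- (+ 1 / 2) ℚ.* 1ℚ ℚ.- (+ 1 / 2) ℚ.* (artanh (2+ k) ℚ.+ artanh (suc k)) ∎
  where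
  open ≡-Reasoning
  X = ((+ 1 / 3) · (geom ⊛ geom) ⊖ (+ 1 / 2) · geom ⊖ (+ 1 / 2) · ((Z ⊕ const 1ℚ) ⊛ artanh)) (2+ k)
  geom⊛geom : (geom ⊛ geom) (2+ k) ≡ + (3 + k) / 1
  geom⊛geom = trans (foldr-+-as-∑ˡ (upTo (3 + k)) (λ _ → 1))
                    (cong (λ t → + t / 1)
                          (trans (∑ˡ-applyUpTo id (3 + k) _) (trans (∑<-const (3 + k) 1) (*-identityʳ (3 + k)))))
  vanishing-tail : ∀ (h : ℕ → ℚ) m (g : ℕ → ℕ) →
                   foldr (λ i acc → (Z ⊕ const 1ℚ) i ℚ.* h i ℚ.+ acc) 0ℚ (applyUpTo (2+ ∘ g) m) ≡ 0ℚ
  vanishing-tail h zero    g = refl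
  vanishing-tail h (suc m) g = cong₂ ℚ._+_ (ℚₚ.*-zeroˡ (h (2+ (g 0)))) (vanishing-tail h m (g ∘ suc))
  [1+z]⊛artanh : ((Z ⊕ const 1ℚ) ⊛ artanh) (2+ k) ≡ artanh (2+ k) ℚ.+ artanh (suc k)
  [1+z]⊛artanh = cong₂ ℚ._+_ (ℚₚ.*-identityˡ (artanh (2+ k)))
    (trans (cong₂ ℚ._+_ (ℚₚ.*-identityˡ (artanh (suc k))) (vanishing-tail (λ i → artanh (2+ k ∸ i)) (suc k) id))
           (ℚₚ.+-identityʳ (artanh (suc k))))

-- o is the odd one of 2 + k and 1 + k, so (1 + z) artanh z contributes 1/o to the coefficient of z^(2+k).
rhsGF-value : ∀ k o e → artanh (2+ k) ℚ.+ artanh (suc k) ≡ + 1 / suc o → 2 * e + suc o + 3 ≡ 2 * suc o * 2+ k →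
              rhsGF (2+ k) ≡ + e / (3 * suc o)
rhsGF-value k o e artanh-sum e-identity = begin
  rhsGF (2+ k)          ≡⟨ rhsGF-2+ k ⟩
  x ℚ.- y ℚ.- ½ ℚ.* (artanh (2+ k) ℚ.+ artanh (suc k)) ≡⟨ cong (λ a → x ℚ.- y ℚ.- ½ ℚ.* a) artanh-sum ⟩
  x ℚ.- y ℚ.- z         ≡⟨ x≡z+y⇒x-y≡z (x ℚ.- y) z w (x≡z+y⇒x-y≡z x y (w ℚ.+ z) x≡w+z+y) ⟩
  w                     ∎
  where
  open ≡-Reasoning
  ½ = + 1 / 2
  x = (+ 1 / 3) ℚ.* (+ (3 + k) / 1)
  y = ½ ℚ.* 1ℚ
  z = ½ ℚ.* (+ 1 / suc o)
  w = + e / (3 * suc o)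
  N = (e * (2 * suc o) + 1 * 1 * (3 * suc o)) * (2 * 1) + 1 * 1 * (3 * suc o * (2 * suc o))
  D = 3 * suc o * (2 * suc o) * (2 * 1)
  cross : 1 * (3 + k) * D ≡ N * (3 * 1)
  cross = begin
    1 * (3 + k) * D
      ≡⟨ expand₁ o k ⟨
    6 * suc o * (2 * suc o * 2+ k + 2 * suc o)
      ≡⟨ cong (λ t → 6 * suc o * (t + 2 * suc o)) e-identity ⟨
    6 * suc o * (2 * e + suc o + 3 + 2 * suc o)
      ≡⟨ expand₂ o e ⟩
    N * (3 * 1) ∎
    where
    expand₁ : ∀ o k → 6 * suc o * (2 * suc o * 2+ k + 2 * suc o) ≡ 1 * (3 + k) * (3 * suc o * (2 * suc o) * (2 * 1))
    expand₁ = solve-∀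
    expand₂ : ∀ o e → 6 * suc o * (2 * e + suc o + 3 + 2 * suc o)
                      ≡ ((e * (2 * suc o) + 1 * 1 * (3 * suc o)) * (2 * 1) + 1 * 1 * (3 * suc o * (2 * suc o))) * (3 * 1)
    expand₂ = solve-∀
  x≡w+z+y : x ≡ w ℚ.+ z ℚ.+ y
  x≡w+z+y = begin
    x
      ≡⟨ /-* 1 3 (3 + k) 1 ⟩
    + (1 * (3 + k)) / (3 * 1)
      ≡⟨ /-cross (1 * (3 + k)) (3 * 1) N D cross ⟩
    + N / D
      ≡⟨ /-+ (e * (2 * suc o) + 1 * 1 * (3 * suc o)) (3 * suc o * (2 * suc o)) (1 * 1) (2 * 1) ⟨
    + (e * (2 * suc o) + 1 * 1 * (3 * suc o)) / (3 * suc o * (2 * suc o)) ℚ.+ + (1 * 1) / (2 * 1)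
      ≡⟨ cong₂ ℚ._+_ (/-+ e (3 * suc o) (1 * 1) (2 * suc o)) (/-* 1 2 1 1) ⟨
    w ℚ.+ + (1 * 1) / (2 * suc o) ℚ.+ y
      ≡⟨ cong (λ t → w ℚ.+ t ℚ.+ y) (/-* 1 2 1 (suc o)) ⟨
    w ℚ.+ z ℚ.+ y ∎

lhsGF-2+ : ∀ k → lhsGF (2+ k) ≡ (+ triangleSpread (2+ k) / 1) ÷ℕ (2+ k C 2)
lhsGF-2+ k = trans (Ex-SML k (λ t → ∣ proj₂ (proj₂ t) - proj₁ t ∣))
                   (cong (λ t → (+ t / 1) ÷ℕ (2+ k C 2)) (triangle-spread (2+ k)))

lhsGF-value : ∀ k o e → 3 * triangleSpread (2+ k) * (2 * suc o) ≡ e * (2+ k * suc k) →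
              lhsGF (2+ k) ≡ + e / (3 * suc o)
lhsGF-value k o e V-identity = begin
  lhsGF (2+ k)                    ≡⟨ lhsGF-2+ k ⟩
  (+ V / 1) ÷ℕ P                  ≡⟨ ÷ℕ-nonZero V P {{P≢0}} ⟩
  ℚ._/_ (+ V) P {{P≢0}}           ≡⟨ /-cross V P e (3 * suc o) {{P≢0}} (*-cancelˡ-≡ _ _ 2 cross) ⟩
  + e / (3 * suc o)               ∎
  where
  open ≡-Reasoning
  V = triangleSpread (2+ k)
  P = 2+ k C 2
  P≢0 : NonZero P
  P≢0 = ℕ.≢-nonZero ([2+k]C2≢0 k)
  cross : 2 * (V * (3 * suc o)) ≡ 2 * (e * P)
  cross = begin
    2 * (V * (3 * suc o))         ≡⟨ regroup₁ V o ⟩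
    3 * V * (2 * suc o)           ≡⟨ V-identity ⟩
    e * (2+ k * suc k)            ≡⟨ cong (e *_) (2*[1+m]C2 (suc k)) ⟨
    e * (2 * P)                   ≡⟨ regroup₂ e P ⟩
    2 * (e * P)                   ∎
    where
    regroup₁ : ∀ v o → 2 * (v * (3 * suc o)) ≡ 3 * v * (2 * suc o)
    regroup₁ = solve-∀
    regroup₂ : ∀ e c → e * (2 * c) ≡ 2 * (e * c)
    regroup₂ = solve-∀

data Parity : ℕ → Set where
  even : ∀ j → Parity (2 * j)
  odd  : ∀ j → Parity (suc (2 * j))

parity : ∀ n → Parity n
parity zero    = even 0
parity (suc n) with parity n
... | even j = odd j
... | odd  j = subst Parity (*-suc 2 j) (even (suc j))

lhsGF≡rhsGF-even : ∀ j → lhsGF (2+ (2 * j)) ≡ rhsGF (2+ (2 * j))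
lhsGF≡rhsGF-even j =
  trans (lhsGF-value (2 * j) (2 * j) e (trans (cong (_* (2 * suc (2 * j))) (triangleSpread-even j)) (V-identity j)))
        (sym (rhsGF-value (2 * j) (2 * j) e artanh-sum (e-identity j)))
  where
  e = j * (4 * j + 5)
  artanh-sum : artanh (2+ (2 * j)) ℚ.+ artanh (suc (2 * j)) ≡ + 1 / suc (2 * j)
  artanh-sum = begin
    artanh (2+ (2 * j)) ℚ.+ artanh (suc (2 * j))
      ≡⟨ cong₂ ℚ._+_ (trans (cong artanh (sym (*-suc 2 j))) (artanh-even (suc j))) (artanh-odd j) ⟩
    0ℚ ℚ.+ + 1 / suc (2 * j)
      ≡⟨ ℚₚ.+-identityˡ _ ⟩
    + 1 / suc (2 * j)                              ∎
    where open ≡-Reasoning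
  e-identity : ∀ j → 2 * (j * (4 * j + 5)) + suc (2 * j) + 3 ≡ 2 * suc (2 * j) * 2+ (2 * j)
  e-identity = solve-∀
  V-identity : ∀ j → j * suc j * (4 * j + 5) * (2 * suc (2 * j)) ≡ j * (4 * j + 5) * (2+ (2 * j) * suc (2 * j))
  V-identity = solve-∀

lhsGF≡rhsGF-odd : ∀ j → lhsGF (3 + 2 * j) ≡ rhsGF (3 + 2 * j)
lhsGF≡rhsGF-odd j =
  trans (lhsGF-value (suc (2 * j)) (2+ (2 * j)) e
                     (trans (cong (_* (2 * (3 + 2 * j))) (triangleSpread-odd j)) (V-identity j)))
        (sym (rhsGF-value (suc (2 * j)) (2+ (2 * j)) e artanh-sum (e-identity j)))
  where
  e = 2+ j * (4 * j + 3)
  artanh-sum : artanh (3 + 2 * j) ℚ.+ artanh (2+ (2 * j)) ≡ + 1 / (3 + 2 * j)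
  artanh-sum = begin
    artanh (3 + 2 * j) ℚ.+ artanh (2+ (2 * j))
      ≡⟨ cong₂ ℚ._+_ (cong (artanh ∘ suc) (*-suc 2 j)) (cong artanh (*-suc 2 j)) ⟨
    artanh (suc (2 * suc j)) ℚ.+ artanh (2 * suc j)
      ≡⟨ cong₂ ℚ._+_ (artanh-odd (suc j)) (artanh-even (suc j)) ⟩
    + 1 / suc (2 * suc j) ℚ.+ 0ℚ
      ≡⟨ ℚₚ.+-identityʳ _ ⟩
    + 1 / suc (2 * suc j)
      ≡⟨ cong (λ m → + 1 / suc m) (*-suc 2 j) ⟩
    + 1 / (3 + 2 * j)                              ∎
    where open ≡-Reasoning
  e-identity : ∀ j → 2 * (2+ j * (4 * j + 3)) + (3 + 2 * j) + 3 ≡ 2 * (3 + 2 * j) * (3 + 2 * j)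
  e-identity = solve-∀
  V-identity : ∀ j → suc j * 2+ j * (4 * j + 3) * (2 * (3 + 2 * j)) ≡ 2+ j * (4 * j + 3) * ((3 + 2 * j) * 2+ (2 * j))
  V-identity = solve-∀

lhsGF≡rhsGF : ∀ n → lhsGF n ≡ rhsGF n
lhsGF≡rhsGF zero       = refl
lhsGF≡rhsGF (suc zero) = refl
lhsGF≡rhsGF (2+ k) with parity k
... | even j = lhsGF≡rhsGF-even j
... | odd  j = lhsGF≡rhsGF-odd j

lemma10p1 : ((n : ℕ) → 2 ≤ n →
    ((s m l : ℕ) →
    (s + m + l ≡ n ∸ 2 → Pr n (λ ω → (S ω ≡ᵇ s) ∧ (M ω ≡ᵇ m) ∧ (L ω ≡ᵇ l)) ≡ 1ℚ ÷ℕ length (Ω′ (n ∸ 2)))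
    × (s + m + l ≢ n ∸ 2 → Pr n (λ ω → (S ω ≡ᵇ s) ∧ (M ω ≡ᵇ m) ∧ (L ω ≡ᵇ l)) ≡ 0ℚ))
    × ((j : ℕ) → (Pr n (λ ω → S ω ≡ᵇ j) ≡ Pr n (λ ω → M ω ≡ᵇ j)) × (Pr n (λ ω → M ω ≡ᵇ j) ≡ Pr n (λ ω → L ω ≡ᵇ j)))
    × ((m : ℕ) → m ≤ n ∸ 2 → Pr n (λ ω → M ω ≡ᵇ m) ≡ (+ (n ∸ m ∸ 1) / 1) ÷ℕ (n C 2))
    × (Ex n M ≡ + (n ∸ 2) / 3))
    × ((k : ℕ) → lhsGF k ≡ rhsGF k)
lemma10p1 =
  (λ { (2+ k) (s≤s (s≤s z≤n)) →
       (λ s m l → Pr-joint-on-Ω′ k s m l , Pr-joint-off-Ω′ k s m l) ,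
       (λ j → trans (Pr[S≡j] k j) (sym (Pr[M≡j] k j)) , trans (Pr[M≡j] k j) (sym (Pr[L≡j] k j))) ,
       (λ m _ → Pr[M≡j]-formula k m) ,
       E[M] k }) ,
  lhsGF≡rhsGF
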